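{- If $\vdash G\triangleright N$, $G$ is bounded and $G\parallel\mathcal M$ is balanced, then the session $N\parallel\mathcal M$ has the progress property.
   Context: Participants $\mathsf p,\mathsf q,\mathsf r,\mathsf s$; labels $\lambda$. Processes are the possibly infinite but regular terms coinductively generated by $P ::= \mathbf 0 \mid \mathsf p!\{\lambda_i;P_i\}_{i\in I}\mid \mathsf p?\{\lambda_i;P_i\}_{i\in I}$, $I$ finite nonempty, $\lambda_i$ pairwise distinct. A network is $N=\mathsf p_1[\![P_1]\!]\parallel\cdots\parallel\mathsf p_n[\![P_n]\!]$ with $n>0$ and pairwise distinct $\mathsf p_i$, taken modulo permutation and adding/removing components $\mathsf p[\![\mathbf 0]\!]$; we write $\mathsf p[\![P]\!]\in N$ ($P\neq\mathbf 0$) if $N\equiv\mathsf p[\![P]\!]\parallel N'$, and $\mathrm{plays}(N)=\{\mathsf p\mid\mathsf p[\![P]\!]\in N\}$. A message is $\langle\mathsf p,\lambda,\mathsf q\rangle$; a queue $\mathcal M$ is a finite sequence of messages ($\emptyset$, $\cdot$), modulo the congruence $\equiv$ generated by $\langle\mathsf p,\lambda,\mathsf q\rangle\cdot\langle\mathsf r,\lambda',\mathsf s\rangle\equiv\langle\mathsf r,\lambda',\mathsf s\rangle\cdot\langle\mathsf p,\lambda,\mathsf q\rangle$ when $\mathsf p\neq\mathsf r$ or $\mathsf q\neq\mathsf s$. Communications $\beta::=\mathsf p\mathsf q!\lambda\mid\mathsf p\mathsf q?\lambda$ (the latter: input by $\mathsf q$ of $\lambda$ from $\mathsf p$), $\mathrm{play}(\mathsf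 p\mathsf q!\lambda)=\mathsf p$, $\mathrm{play}(\mathsf p\mathsf q?\lambda)=\mathsf q$. Sessions $N\parallel\mathcal M$ reduce by: $\mathsf p[\![\mathsf q!\{\lambda_i;P_i\}_{i\in I}]\!]\parallel N\parallel\mathcal M\xrightarrow{\mathsf p\mathsf q!\lambda_h}\mathsf p[\![P_h]\!]\parallel N\parallel\mathcal M\cdot\langle\mathsf p,\lambda_h,\mathsf q\rangle$ and $\mathsf q[\![\mathsf p?\{\lambda_i;Q_i\}_{i\in I}]\!]\parallel N\parallel\langle\mathsf p,\lambda_h,\mathsf q\rangle\cdot\mathcal M\xrightarrow{\mathsf p\mathsf q?\lambda_h}\mathsf q[\![Q_h]\!]\parallel N\parallel\mathcal M$, $h\in I$. Lockstep: a nonempty set $\Delta$ of communications is coherent for a session $S$ if distinct elements of $\Delta$ have distinct players and $S$ has a $\beta$-transition for each $\beta\in\Delta$; $S\Rightarrow_\Delta S'$ if $\Delta=\{\beta_1,\ldots,\beta_n\}$ is a maximal coherent set for $S$ and $S\xrightarrow{\beta_1}\cdots\xrightarrow{\beta_n}S'$. A lockstep derivative of $S$ is any session reachable by finitely many (possibly zero) lockstep transitions. A complete lockstep computation from $S$ is a sequence $S=S_0\Rightarrow_{\Delta_0}S_1\Rightarrow_{\Delta_1}\cdots$ which is infinite or finite with last session having no transition. A session $N\parallel\mathcal M$ is terminated if $N\equiv\mathsf p[\![\mathbf 0]\!]$ and $\mathcal M=\emptyset$, and deadlocked if it has no transition and is not terminated. It is input-enabling if whenever $\mathsf p[\![\mathsf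 q?\{\lambda_i;P_i\}_{i\in I}]\!]\in N$, every complete lockstep computation from it has a step $h$ with $\mathsf q\mathsf p?\lambda_j\in\Delta_h$ for some $j\in I$; it is queue-consuming if whenever $\mathcal M\equiv\langle\mathsf p,\lambda,\mathsf q\rangle\cdot\mathcal M'$, every complete lockstep computation from it has a step $h$ with $\mathsf p\mathsf q?\lambda\in\Delta_h$. A session has the progress property if none of its lockstep derivatives is deadlocked, and all its lockstep derivatives are input-enabling and queue-consuming. Global types: possibly infinite regular terms $G ::= \mathsf{End}\mid \mathsf p\mathsf q!\{\lambda_i;G_i\}_{i\in I}\mid\mathsf p\mathsf q?\{\lambda_i;G_i\}_{i\in I}$ ($I$ finite nonempty, $\mathsf p\neq\mathsf q$, $\lambda_i$ distinct); $\mathsf p\mathsf q\dagger$ denotes either form. $\mathrm{play}(\mathsf p\mathsf q!\{\ldots\})=\mathsf p$, $\mathrm{play}(\mathsf p\mathsf q?\{\ldots\})=\mathsf q$; $\mathrm{plays}(G)$ least set with $\mathrm{plays}(\mathsf{End})=\emptyset$, $\mathrm{plays}(G)=\{\mathrm{play}(G)\}\cup\bigcup_i\mathrm{plays}(G_i)$. Typing $\vdash G\triangleright N$ (coinductive): (End) $\vdash\mathsf{End}\triangleright\mathsf p[\![\mathbf 0]\!]$; (Out) if $\forall i\in I$: $\vdash G_i\triangleright\mathsf p[\![P_i]\!]\parallel N$ and $\mathrm{plays}(G_i)\setminus\{\mathsf p\}=\mathrm{plays}(N)$, then $\vdash\mathsf p\mathsf q!\{\lambda_i;G_i\}_{i\in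 I}\triangleright\mathsf p[\![\mathsf q!\{\lambda_i;P_i\}_{i\in I}]\!]\parallel N$; (In) if $I\subseteq J$ and $\forall i\in I$: $\vdash G_i\triangleright\mathsf p[\![P_i]\!]\parallel N$ and $\mathrm{plays}(G_i)\setminus\{\mathsf p\}=\mathrm{plays}(N)$, then $\vdash\mathsf q\mathsf p?\{\lambda_i;G_i\}_{i\in I}\triangleright\mathsf p[\![\mathsf q?\{\lambda_j;P_j\}_{j\in J}]\!]\parallel N$. Boundedness: $\mathrm{Paths}(G)$ is the greatest family with $\mathrm{Paths}(\mathsf{End})=\{\epsilon\}$ and $\mathrm{Paths}(\mathsf p\mathsf q\dagger\{\lambda_i;G_i\}_{i\in I})=\bigcup_{i}\{\mathsf p\mathsf q\dagger\lambda_i\cdot\xi\mid\xi\in\mathrm{Paths}(G_i)\}$; $\mathrm{depth}(\xi,\mathsf p)=\inf\{n\mid\mathrm{play}(\xi_n)=\mathsf p\}$ ($\inf\emptyset=\infty$); $\mathrm{depth}(G,\mathsf p)=1+\sup\{\mathrm{depth}(\xi,\mathsf p)\mid\xi\in\mathrm{Paths}(G)\}$ if $\mathsf p\in\mathrm{plays}(G)$, else $0$. $G$ is bounded if $\mathrm{depth}(G',\mathsf p)<\infty$ for all $G'$ occurring in $G$ and all $\mathsf p\in\mathrm{plays}(G')$. Readability $\mathrm{read}(G,\mathcal M)$ (inductive): $\mathrm{read}(G,\emptyset)$; $\mathrm{read}(\mathsf p\mathsf q!\{\lambda_i;G_i\}_{i\in I},\mathcal M)$ if $\mathrm{read}(G_i,\mathcal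 M)$ $\forall i$; $\mathrm{read}(\mathsf p\mathsf q?\{\lambda_i;G_i\}_{i\in I},\langle\mathsf p,\lambda_h,\mathsf q\rangle\cdot\mathcal M)$ if $h\in I$ and $\mathrm{read}(G_i,\mathcal M)$ $\forall i$; $\mathrm{read}(\mathsf p\mathsf q?\{\lambda_i;G_i\}_{i\in I},\mathcal M)$ if $\mathcal M\not\equiv\langle\mathsf p,\lambda_i,\mathsf q\rangle\cdot\mathcal M'$ for all $i\in I$, $\mathcal M'$, and $\mathrm{read}(G_i,\mathcal M)$ $\forall i$. Balancing (coinductive): $\mathsf{End}\parallel\emptyset$ is balanced; $G=\mathsf p\mathsf q!\{\lambda_i;G_i\}_{i\in I}$ with $\mathcal M$ is balanced if $\mathrm{read}(G,\mathcal M)$ and each $G_i\parallel\mathcal M\cdot\langle\mathsf p,\lambda_i,\mathsf q\rangle$ is balanced; $G=\mathsf p\mathsf q?\{\lambda_i;G_i\}_{i\in I}$ with $\langle\mathsf p,\lambda_h,\mathsf q\rangle\cdot\mathcal M$, $h\in I$, is balanced if $\mathrm{read}(G,\langle\mathsf p,\lambda_h,\mathsf q\rangle\cdot\mathcal M)$ and $G_h\parallel\mathcal M$ is balanced. -}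

module Defs where

open import Data.Nat using (ℕ; zero; suc; _<_; _≟_)
open import Data.Fin using (Fin)
open import Data.List using (List; []; _∷_; _++_; [_])
open import Data.List.Membership.Propositional using (_∈_; _∉_)
open import Data.List.Relation.Binary.Subset.Propositional using (_⊆_)
open import Data.List.Relation.Unary.All using (All)
open import Data.List.Relation.Unary.AllPairs using (AllPairs)
open import Data.Maybe using (Maybe; just; nothing)
open import Data.Product using (Σ; ∃; ∃-syntax; _×_; _,_)
open import Data.Sum using (_⊎_)
open import Data.Unit using (⊤)
open import Data.Empty using (⊥)
open import Function.Definitions using (Injective)
open import Relation.Nullary using (¬_; yes; no)
open import Relation.Binary.PropositionalEquality using (_≡_; _≢_)
open import Relation.Binary.Construct.Closure.ReflexiveTransitive using (Star)

Participant : Set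
Participant = ℕ

Label : Set
Label = ℕ

-- A finite nonempty branching {λ_i ; x_i}_{i ∈ I} with pairwise distinct
-- labels; I is represented by Fin (suc n).
record Choice (A : Set) : Set where
  field
    n        : ℕ
    lab      : Fin (suc n) → Label
    distinct : Injective _≡_ _≡_ lab
    cont     : Fin (suc n) → A
open Choice public

data Dir : Set where
  out inp : Dir

-- Processes: possibly infinite REGULAR terms, presented as a finite
-- system of equations (finitely many nodes) with a root node.

data PNode (k : ℕ) : Set where
  pend : PNode k
  pact : Dir → Participant → Choice (Fin k) → PNode k

record Proc : Set where
  field
    size  : ℕ
    graph : Fin size → PNode size
    root  : Fin size
open Proc public

pnode : (P : Proc) → PNode (size P)
pnode P = graph P (root P)

goto : (P : Proc) → Fin (size P) → Proc
goto P i = record P { root = i }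

IsEnd : Proc → Set
IsEnd P = pnode P ≡ pend

-- Networks: maps from participants to processes, with finitely many
-- components different from 0 (this builds in the identification modulo
-- permutation and adding/removing p[[0]] components).

Network : Set
Network = Participant → Proc

IsNetwork : Network → Set
IsNetwork N = ∃[ L ] (∀ p → p ∉ L → IsEnd (N p))

InPlaysN : Network → Participant → Set
InPlaysN N p = ¬ IsEnd (N p)

update : Network → Participant → Proc → Network
update N p P r with r ≟ p
... | yes _ = P
... | no  _ = N r

data Msg : Set where
  msg : Participant → Label → Participant → Msg

sender receiver : Msg → Participant
sender   (msg p _ _) = p
receiver (msg _ _ q) = q

Queue : Set
Queue = List Msg

data _≈Q_ : Queue → Queue → Set where
  qrefl  : ∀ {M} → M ≈Q M
  qsym   : ∀ {M M'} → M ≈Q M' → M' ≈Q M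
  qtrans : ∀ {M M' M''} → M ≈Q M' → M' ≈Q M'' → M ≈Q M''
  qswap  : ∀ l r m m' → (sender m ≢ sender m' ⊎ receiver m ≢ receiver m') →
           (l ++ m ∷ m' ∷ r) ≈Q (l ++ m' ∷ m ∷ r)

data Comm : Set where
  cout : Participant → Participant → Label → Comm
  cin  : Participant → Participant → Label → Comm

play : Comm → Participant
play (cout p q _) = p
play (cin  p q _) = q

Session : Set
Session = Network × Queue

data Step : Session → Comm → Session → Set where
  stOut : ∀ {N M p q} {c : Choice (Fin (size (N p)))} →
          pnode (N p) ≡ pact out q c → (h : Fin (suc (n c))) →
          Step (N , M) (cout p q (lab c h))
               (update N p (goto (N p) (cont c h)) , M ++ [ msg p (lab c h) q ])
  stIn  : ∀ {N M M' p q} {c : Choice (Fin (size (N q)))} →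
          pnode (N q) ≡ pact inp p c → (h : Fin (suc (n c))) →
          M ≈Q (msg p (lab c h) q ∷ M') →
          Step (N , M) (cin p q (lab c h))
               (update N q (goto (N q) (cont c h)) , M')

Stuck : Session → Set
Stuck S = ∀ β S' → ¬ Step S β S'

Terminated : Session → Set
Terminated (N , M) = (∀ p → IsEnd (N p)) × M ≡ []

Deadlocked : Session → Set
Deadlocked S = Stuck S × ¬ Terminated S

-- Lockstep semantics (a finite set of communications is a list)

Coherent : Session → List Comm → Set
Coherent S Δ = (Δ ≢ []) × AllPairs (λ β β' → play β ≢ play β') Δ
             × All (λ β → ∃[ S' ] Step S β S') Δ

MaxCoherent : Session → List Comm → Set
MaxCoherent S Δ = Coherent S Δ × (∀ Δ' → Coherent S Δ' → Δ ⊆ Δ' → Δ' ⊆ Δ)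

data Steps : Session → List Comm → Session → Set where
  snil  : ∀ {S} → Steps S [] S
  scons : ∀ {S S₁ S₂ β Δ} → Step S β S₁ → Steps S₁ Δ S₂ → Steps S (β ∷ Δ) S₂

LStep : Session → List Comm → Session → Set
LStep S Δ S' = MaxCoherent S Δ × Steps S Δ S'

Derivative : Session → Session → Set
Derivative = Star (λ S S' → ∃[ Δ ] LStep S Δ S')

-- index i is a step of a computation of length len (nothing = infinite)
ValidIx : Maybe ℕ → ℕ → Set
ValidIx nothing  i = ⊤
ValidIx (just k) i = i < k

EndsStuck : Maybe ℕ → (ℕ → Session) → Set
EndsStuck nothing  s = ⊤
EndsStuck (just k) s = Stuck (s k)

record Computation (S : Session) : Set where
  field
    len   : Maybe ℕ
    sess  : ℕ → Session
    acts  : ℕ → List Comm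
    init  : sess 0 ≡ S
    steps : ∀ i → ValidIx len i → LStep (sess i) (acts i) (sess (suc i))
    final : EndsStuck len sess
open Computation public

Occurs : ∀ {S} → Computation S → Comm → Set
Occurs C β = ∃[ h ] (ValidIx (len C) h × β ∈ acts C h)

InputEnabling : Session → Set
InputEnabling (N , M) =
  ∀ p q (c : Choice (Fin (size (N p)))) → pnode (N p) ≡ pact inp q c →
  (C : Computation (N , M)) → ∃[ j ] Occurs C (cin q p (lab c j))

QueueConsuming : Session → Set
QueueConsuming (N , M) =
  ∀ p l q M' → M ≈Q (msg p l q ∷ M') →
  (C : Computation (N , M)) → Occurs C (cin p q l)

Progress : Session → Set
Progress S = ∀ S' → Derivative S S' →
  ¬ Deadlocked S' × InputEnabling S' × QueueConsuming S'

-- Global types: possibly infinite regular terms (finite presentations)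

data GNode (k : ℕ) : Set where
  gend  : GNode k
  gcomm : Dir → (p q : Participant) → p ≢ q → Choice (Fin k) → GNode k

record GType : Set where
  field
    gsize  : ℕ
    ggraph : Fin gsize → GNode gsize
    groot  : Fin gsize
open GType public

gnode : (G : GType) → GNode (gsize G)
gnode G = ggraph G (groot G)

ggoto : (G : GType) → Fin (gsize G) → GType
ggoto G i = record G { groot = i }

playOf : Dir → Participant → Participant → Participant
playOf out p q = p
playOf inp p q = q

data Plays (G : GType) : Participant → Set where
  phere  : ∀ {d p q ne c} → gnode G ≡ gcomm d p q ne c → Plays G (playOf d p q)
  pthere : ∀ {d p q ne c r} → gnode G ≡ gcomm d p q ne c →
           (i : Fin (suc (n c))) → Plays (ggoto G (cont c i)) r → Plays G r

PlaysRest : GType → Participant → Network → Set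
PlaysRest G p N = ∀ r → r ≢ p → (Plays G r → InPlaysN N r) × (InPlaysN N r → Plays G r)

data TyRule (G : GType) (N : Network) : Set
record Typed (G : GType) (N : Network) : Set where
  coinductive
  field rule : TyRule G N

data TyRule G N where
  tEnd : gnode G ≡ gend → (∀ r → IsEnd (N r)) → TyRule G N
  tOut : ∀ {p q ne c} {pc : Choice (Fin (size (N p)))} →
         gnode G ≡ gcomm out p q ne c → pnode (N p) ≡ pact out q pc →
         (∀ i → ∃[ j ] (lab pc j ≡ lab c i)) →
         (∀ j → ∃[ i ] (lab c i ≡ lab pc j)) →
         (∀ i j → lab c i ≡ lab pc j →
            Typed (ggoto G (cont c i)) (update N p (goto (N p) (cont pc j)))
            × PlaysRest (ggoto G (cont c i)) p N) →
         TyRule G N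
  tIn  : ∀ {p q ne c} {pc : Choice (Fin (size (N p)))} →
         gnode G ≡ gcomm inp q p ne c → pnode (N p) ≡ pact inp q pc →
         (∀ i → ∃[ j ] (lab pc j ≡ lab c i)) →
         (∀ i j → lab c i ≡ lab pc j →
            Typed (ggoto G (cont c i)) (update N p (goto (N p) (cont pc j)))
            × PlaysRest (ggoto G (cont c i)) p N) →
         TyRule G N

data Occurring (G : GType) : GType → Set where
  oself  : Occurring G G
  ochild : ∀ {d p q ne c G'} → gnode G ≡ gcomm d p q ne c →
           (i : Fin (suc (n c))) → Occurring (ggoto G (cont c i)) G' → Occurring G G'

-- Within B G r : every path ξ ∈ Paths(G) has depth(ξ, r) ≤ B, i.e.
-- some among its first B communications is played by r.
data Within : ℕ → GType → Participant → Set where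
  wHere  : ∀ {B G d p q ne c} → gnode G ≡ gcomm d p q ne c →
           Within (suc B) G (playOf d p q)
  wthere : ∀ {B G d p q ne c r} → gnode G ≡ gcomm d p q ne c →
           (∀ i → Within B (ggoto G (cont c i)) r) → Within (suc B) G r

DepthFinite : GType → Participant → Set
DepthFinite G r = ∃[ B ] Within B G r

Bounded : GType → Set
Bounded G = ∀ G' → Occurring G G' → ∀ r → Plays G' r → DepthFinite G' r

data Read (G : GType) : Queue → Set where
  rEmpty : Read G []
  rOut   : ∀ {p q ne c M} → gnode G ≡ gcomm out p q ne c →
           (∀ i → Read (ggoto G (cont c i)) M) → Read G M
  rInHit : ∀ {p q ne c M M'} → gnode G ≡ gcomm inp p q ne c →
           (h : Fin (suc (n c))) → M ≈Q (msg p (lab c h) q ∷ M') →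
           (∀ i → Read (ggoto G (cont c i)) M') → Read G M
  rInMiss : ∀ {p q ne c M} → gnode G ≡ gcomm inp p q ne c →
           (∀ i M' → ¬ (M ≈Q (msg p (lab c i) q ∷ M'))) →
           (∀ i → Read (ggoto G (cont c i)) M) → Read G M

data BalRule (G : GType) (M : Queue) : Set
record Balanced (G : GType) (M : Queue) : Set where
  coinductive
  field brule : BalRule G M

data BalRule G M where
  bEnd : gnode G ≡ gend → M ≡ [] → BalRule G M
  bOut : ∀ {p q ne c} → gnode G ≡ gcomm out p q ne c → Read G M →
         (∀ i → Balanced (ggoto G (cont c i)) (M ++ [ msg p (lab c i) q ])) →
         BalRule G M
  bIn  : ∀ {p q ne c M'} → gnode G ≡ gcomm inp p q ne c →
         (h : Fin (suc (n c))) → M ≈Q (msg p (lab c h) q ∷ M') →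
         Read G M → Balanced (ggoto G (cont c h)) M' → BalRule G M

{-# OPTIONS --safe #-}
-- From ⊢ G ▷ N, balancing of G ∥ M and boundedness of G we build an
-- invariant relating a tree (G, later a reduct of G) to the session: one
-- level of the typing rules at every node, plus a measure saying that
-- every active participant, and the input of every queued message, is met
-- within finitely many levels along the paths that the queue allows.  A
-- step β preserves the invariant once the communication of β is removed
-- from the tree (subject reduction).  The root of the tree can always
-- fire, which excludes deadlock; and its player belongs to every maximal
-- coherent set, so each lockstep step either performs the awaited input
-- or strictly decreases the measure.  This gives input-enabling and
-- queue-consumption along every complete lockstep computation.
module Submission where

open import Defs
open import Data.Nat using (ℕ; zero; suc; _≟_; _≤_; z≤n; s≤s; _⊔_)
open import Data.Nat.Properties using (≤-trans; m≤m⊔n; m≤n⊔m; n≤1+n; m≤n⇒m<n∨m≡n)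
open import Data.Fin using (Fin; zero; suc)
open import Data.Fin.Properties using () renaming (any? to finAny?)
open import Data.List using (List; []; _∷_; _++_; [_]; drop)
open import Data.List.Properties using (∷-injective; ++-assoc; ++-identityʳ)
open import Data.List.Relation.Unary.All as All using (All; []; _∷_; lookup)
open import Data.List.Relation.Unary.All.Properties using (¬Any⇒All¬)
open import Data.List.Relation.Unary.AllPairs using (_∷_)
open import Data.List.Relation.Unary.Any using (Any; here; there; any?)
open import Data.List.Membership.Propositional using (_∈_; find; lose)
open import Data.Maybe using (Maybe; just; nothing)
open import Data.Product using (Σ; ∃-syntax; _×_; _,_; proj₁; proj₂)
open import Data.Sum using (_⊎_; inj₁; inj₂; [_,_]′)
open import Data.Empty using (⊥; ⊥-elim)
open import Data.Unit using (⊤; tt)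
open import Relation.Nullary using (¬_; yes; no; Dec)
open import Relation.Binary.PropositionalEquality hiding ([_])
open import Relation.Binary.Construct.Closure.ReflexiveTransitive using (ε; _◅_)

open ≡-Reasoning

-- Queues as families of channels

SameChannel : Participant → Participant → Participant → Participant → Set
SameChannel a b s r = (a ≡ s) × (b ≡ r)

SameChannel-sym : ∀ {a b s r} → SameChannel a b s r → SameChannel s r a b
SameChannel-sym (refl , refl) = refl , refl

sameChannel? : ∀ a b s r → Dec (SameChannel a b s r)
sameChannel? a b s r with a ≟ s | b ≟ r
... | yes a≡s | yes b≡r = yes (a≡s , b≡r)
... | no a≢s  | _       = no λ { (a≡s , _) → a≢s a≡s }
... | yes _   | no b≢r  = no λ { (_ , b≡r) → b≢r b≡r }

labelsOn : Participant → Participant → Queue → List Label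
labelsOn s r [] = []
labelsOn s r (msg a l b ∷ X) with sameChannel? a b s r
... | yes _ = l ∷ labelsOn s r X
... | no _  = labelsOn s r X

labelsOn-here : ∀ {a b s r l X} → SameChannel a b s r →
                labelsOn s r (msg a l b ∷ X) ≡ l ∷ labelsOn s r X
labelsOn-here {a} {b} {s} {r} same with sameChannel? a b s r
... | yes _    = refl
... | no other = ⊥-elim (other same)

labelsOn-head : ∀ a b l X → labelsOn a b (msg a l b ∷ X) ≡ l ∷ labelsOn a b X
labelsOn-head a b l X = labelsOn-here {l = l} {X = X} (refl , refl)

labelsOn-skip : ∀ {a b s r l X} → ¬ SameChannel a b s r →
                labelsOn s r (msg a l b ∷ X) ≡ labelsOn s r X
labelsOn-skip {a} {b} {s} {r} other with sameChannel? a b s r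
... | yes same = ⊥-elim (other same)
... | no _     = refl

labelsOn-++ : ∀ s r X Y → labelsOn s r (X ++ Y) ≡ labelsOn s r X ++ labelsOn s r Y
labelsOn-++ s r [] Y = refl
labelsOn-++ s r (msg a l b ∷ X) Y with sameChannel? a b s r
... | yes _ = cong (l ∷_) (labelsOn-++ s r X Y)
... | no _  = labelsOn-++ s r X Y

-- Two queues are ≈Q-equivalent iff they agree channel by channel
-- (≈Q⇒~ and head⇒≈Q∷dropChannel); _~_ is the tractable side of that.
infix 4 _~_
record _~_ (M M' : Queue) : Set where
  constructor mk~
  field onChannel : ∀ s r → labelsOn s r M ≡ labelsOn s r M'
open _~_ public

~-refl : ∀ {M} → M ~ M
~-refl = mk~ λ s r → refl

~-sym : ∀ {M M'} → M ~ M' → M' ~ M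
~-sym e = mk~ λ s r → sym (onChannel e s r)

~-trans : ∀ {M M' M''} → M ~ M' → M' ~ M'' → M ~ M''
~-trans e f = mk~ λ s r → trans (onChannel e s r) (onChannel f s r)

≡⇒~ : ∀ {X Y} → X ≡ Y → X ~ Y
≡⇒~ refl = ~-refl

~-++ : ∀ {M M'} K → M ~ M' → (M ++ K) ~ (M' ++ K)
~-++ {M} {M'} K e = mk~ λ s r → begin
  labelsOn s r (M ++ K)                  ≡⟨ labelsOn-++ s r M K ⟩
  labelsOn s r M ++ labelsOn s r K       ≡⟨ cong (_++ labelsOn s r K) (onChannel e s r) ⟩
  labelsOn s r M' ++ labelsOn s r K      ≡⟨ labelsOn-++ s r M' K ⟨
  labelsOn s r (M' ++ K)                 ∎

HeadIs : Queue → Participant → Label → Participant → Queue → Set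
HeadIs M a l b X = (labelsOn a b M ≡ l ∷ labelsOn a b X)
                 × (∀ s r → ¬ SameChannel a b s r → labelsOn s r M ≡ labelsOn s r X)

~∷⇒HeadIs : ∀ {M a l b X} → M ~ (msg a l b ∷ X) → HeadIs M a l b X
~∷⇒HeadIs {a = a} {l} {b} {X} e = trans (onChannel e a b) (labelsOn-head a b l X)
                                 , λ s r other → trans (onChannel e s r) (labelsOn-skip {l = l} {X = X} other)

HeadIs⇒~∷ : ∀ {M a l b X} → HeadIs M a l b X → M ~ (msg a l b ∷ X)
HeadIs⇒~∷ {M} {a} {l} {b} {X} (onab , onOther) = mk~ λ s r → on s r (sameChannel? a b s r)
  where
  on : ∀ s r → Dec (SameChannel a b s r) → labelsOn s r M ≡ labelsOn s r (msg a l b ∷ X)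
  on s r (yes (refl , refl)) = trans onab (sym (labelsOn-head a b l X))
  on s r (no other)          = trans (onOther s r other) (sym (labelsOn-skip other))

~∷-unique : ∀ {M a l l' b X Y} → M ~ (msg a l b ∷ X) → M ~ (msg a l' b ∷ Y) → (l ≡ l') × (X ~ Y)
~∷-unique {M} {a} {l} {l'} {b} {X} {Y} e f = proj₁ heads , mk~ λ s r → on s r (sameChannel? a b s r)
  where
  heads = ∷-injective (trans (sym (proj₁ (~∷⇒HeadIs e))) (proj₁ (~∷⇒HeadIs f)))
  on : ∀ s r → Dec (SameChannel a b s r) → labelsOn s r X ≡ labelsOn s r Y
  on s r (yes (refl , refl)) = proj₂ heads
  on s r (no other) = trans (sym (proj₂ (~∷⇒HeadIs e) s r other)) (proj₂ (~∷⇒HeadIs f) s r other)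

dropChannel : Participant → Participant → Queue → Queue
dropChannel a b [] = []
dropChannel a b (msg s l r ∷ X) with sameChannel? s r a b
... | yes _ = X
... | no _  = msg s l r ∷ dropChannel a b X

dropChannel-here : ∀ {a b s r l X} → SameChannel s r a b → dropChannel a b (msg s l r ∷ X) ≡ X
dropChannel-here {a} {b} {s} {r} same with sameChannel? s r a b
... | yes _    = refl
... | no other = ⊥-elim (other same)

dropChannel-skip : ∀ {a b s r l X} → ¬ SameChannel s r a b →
                   dropChannel a b (msg s l r ∷ X) ≡ msg s l r ∷ dropChannel a b X
dropChannel-skip {a} {b} {s} {r} other with sameChannel? s r a b
... | yes same = ⊥-elim (other same)
... | no _     = refl

labelsOn-dropChannel : ∀ a b X → labelsOn a b (dropChannel a b X) ≡ drop 1 (labelsOn a b X)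
labelsOn-dropChannel a b [] = refl
labelsOn-dropChannel a b (msg s l r ∷ X) with sameChannel? s r a b
... | yes (refl , refl) = refl
... | no other          = trans (labelsOn-skip other) (labelsOn-dropChannel a b X)

labelsOn-dropChannel-other : ∀ a b s r X → ¬ SameChannel a b s r →
                             labelsOn s r (dropChannel a b X) ≡ labelsOn s r X
labelsOn-dropChannel-other a b s r [] other = refl
labelsOn-dropChannel-other a b s r (msg s' l r' ∷ X) other with sameChannel? s' r' a b
... | yes (refl , refl) = sym (labelsOn-skip other)
... | no _ with sameChannel? s' r' s r
...   | yes _ = cong (l ∷_) (labelsOn-dropChannel-other a b s r X other)
...   | no _  = labelsOn-dropChannel-other a b s r X other

head⇒~∷dropChannel : ∀ {X a l b L} → labelsOn a b X ≡ l ∷ L → X ~ (msg a l b ∷ dropChannel a b X)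
head⇒~∷dropChannel {X} {a} {l} {b} e = HeadIs⇒~∷ (onab , λ s r other → sym (labelsOn-dropChannel-other a b s r X other))
  where
  onab : labelsOn a b X ≡ l ∷ labelsOn a b (dropChannel a b X)
  onab = trans e (cong (l ∷_) (trans (cong (drop 1) (sym e)) (sym (labelsOn-dropChannel a b X))))

~∷⇒~∷dropChannel : ∀ {X a l b Y} → X ~ (msg a l b ∷ Y) → X ~ (msg a l b ∷ dropChannel a b X)
~∷⇒~∷dropChannel e = head⇒~∷dropChannel (proj₁ (~∷⇒HeadIs e))

~∷-other : ∀ {M a l b a' l' b' X1 X2} → ¬ SameChannel a b a' b' →
  M ~ (msg a l b ∷ X1) → M ~ (msg a' l' b' ∷ X2) → X1 ~ (msg a' l' b' ∷ dropChannel a' b' X1)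
~∷-other other e f = head⇒~∷dropChannel (trans (sym (proj₂ (~∷⇒HeadIs e) _ _ other)) (proj₁ (~∷⇒HeadIs f)))

~∷-swap : ∀ {M a l b a' l' b' X1 X2 Y} → ¬ SameChannel a b a' b' →
  M ~ (msg a l b ∷ X1) → M ~ (msg a' l' b' ∷ X2) → X1 ~ (msg a' l' b' ∷ Y) → X2 ~ (msg a l b ∷ Y)
~∷-swap {M} {a} {l} {b} {a'} {l'} {b'} {X1} {X2} {Y} other e f g = HeadIs⇒~∷ (onab , on)
  where
  other′ = λ same → other (SameChannel-sym same)
  onab : labelsOn a b X2 ≡ l ∷ labelsOn a b Y
  onab = trans (sym (proj₂ (~∷⇒HeadIs f) a b other′))
               (trans (proj₁ (~∷⇒HeadIs e)) (cong (l ∷_) (proj₂ (~∷⇒HeadIs g) a b other′)))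
  on′ : ∀ s r → ¬ SameChannel a b s r → Dec (SameChannel a' b' s r) → labelsOn s r X2 ≡ labelsOn s r Y
  on′ s r _ (yes (refl , refl)) = proj₂ (∷-injective (trans (sym (proj₁ (~∷⇒HeadIs f)))
                                   (trans (proj₂ (~∷⇒HeadIs e) a' b' other) (proj₁ (~∷⇒HeadIs g)))))
  on′ s r ab (no a'b') = trans (sym (proj₂ (~∷⇒HeadIs f) s r a'b'))
                           (trans (proj₂ (~∷⇒HeadIs e) s r ab) (proj₂ (~∷⇒HeadIs g) s r a'b'))
  on : ∀ s r → ¬ SameChannel a b s r → labelsOn s r X2 ≡ labelsOn s r Y
  on s r ab = on′ s r ab (sameChannel? a' b' s r)

labelsOn-swap : ∀ s r m m' → (sender m ≢ sender m' ⊎ receiver m ≢ receiver m') →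
  labelsOn s r (m ∷ m' ∷ []) ≡ labelsOn s r (m' ∷ m ∷ [])
labelsOn-swap s r (msg a l b) (msg a' l' b') apart = byChannel (sameChannel? a b s r) (sameChannel? a' b' s r)
  where
  byChannel : Dec (SameChannel a b s r) → Dec (SameChannel a' b' s r) →
       labelsOn s r (msg a l b ∷ msg a' l' b' ∷ []) ≡ labelsOn s r (msg a' l' b' ∷ msg a l b ∷ [])
  byChannel (yes (refl , refl)) (yes (refl , refl)) = ⊥-elim ([ (λ a≢a → a≢a refl) , (λ b≢b → b≢b refl) ]′ apart)
  byChannel (yes e) (no n) = trans (labelsOn-here e) (trans (cong (l ∷_) (labelsOn-skip n))
                        (sym (trans (labelsOn-skip n) (labelsOn-here e))))
  byChannel (no n) (yes e) = trans (labelsOn-skip n) (trans (labelsOn-here e)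
                        (sym (trans (labelsOn-here e) (cong (l' ∷_) (labelsOn-skip n)))))
  byChannel (no n) (no n') = trans (labelsOn-skip n) (trans (labelsOn-skip n')
                        (sym (trans (labelsOn-skip n') (labelsOn-skip n))))

≈Q⇒~ : ∀ {X Y} → X ≈Q Y → X ~ Y
≈Q⇒~ qrefl = ~-refl
≈Q⇒~ (qsym e) = ~-sym (≈Q⇒~ e)
≈Q⇒~ (qtrans e f) = ~-trans (≈Q⇒~ e) (≈Q⇒~ f)
≈Q⇒~ (qswap L R m m' apart) = mk~ λ s r → begin
  labelsOn s r (L ++ m ∷ m' ∷ R)                                ≡⟨ labelsOn-++ s r L _ ⟩
  labelsOn s r L ++ labelsOn s r (m ∷ m' ∷ [] ++ R)             ≡⟨ cong (labelsOn s r L ++_) (labelsOn-++ s r (m ∷ m' ∷ []) R) ⟩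
  labelsOn s r L ++ labelsOn s r (m ∷ m' ∷ []) ++ labelsOn s r R
    ≡⟨ cong (λ x → labelsOn s r L ++ x ++ labelsOn s r R) (labelsOn-swap s r m m' apart) ⟩
  labelsOn s r L ++ labelsOn s r (m' ∷ m ∷ []) ++ labelsOn s r R ≡⟨ cong (labelsOn s r L ++_) (labelsOn-++ s r (m' ∷ m ∷ []) R) ⟨
  labelsOn s r L ++ labelsOn s r (m' ∷ m ∷ [] ++ R)             ≡⟨ labelsOn-++ s r L _ ⟨
  labelsOn s r (L ++ m' ∷ m ∷ R)                                ∎

~[]⇒≡[] : ∀ {M} → M ~ [] → M ≡ []
~[]⇒≡[] {[]} e = refl
~[]⇒≡[] {msg a l b ∷ M} e with trans (sym (labelsOn-head a b l M)) (onChannel e a b)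
... | ()

≈Q-∷ : ∀ {X Y} x → X ≈Q Y → (x ∷ X) ≈Q (x ∷ Y)
≈Q-∷ x qrefl = qrefl
≈Q-∷ x (qsym e) = qsym (≈Q-∷ x e)
≈Q-∷ x (qtrans e f) = qtrans (≈Q-∷ x e) (≈Q-∷ x f)
≈Q-∷ x (qswap L R m m' apart) = qswap (x ∷ L) R m m' apart

head⇒≈Q∷dropChannel : ∀ {X a l b L} → labelsOn a b X ≡ l ∷ L → X ≈Q (msg a l b ∷ dropChannel a b X)
head⇒≈Q∷dropChannel {[]} ()
head⇒≈Q∷dropChannel {msg s l' r ∷ X} {a} {l} {b} e = byChannel (sameChannel? s r a b)
  where
  byChannel : Dec (SameChannel s r a b) → (msg s l' r ∷ X) ≈Q (msg a l b ∷ dropChannel a b (msg s l' r ∷ X))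
  byChannel (yes same@(refl , refl)) with trans (sym (labelsOn-head s r l' X)) e
  ... | refl rewrite dropChannel-here {l = l'} {X = X} same = qrefl
  byChannel (no other) rewrite dropChannel-skip {l = l'} {X = X} other =
    qtrans (≈Q-∷ (msg s l' r) (head⇒≈Q∷dropChannel (trans (sym (labelsOn-skip other)) e)))
           (qswap [] (dropChannel a b X) (msg s l' r) (msg a l b) apart)
    where
    apart : s ≢ a ⊎ r ≢ b
    apart with s ≟ a
    ... | yes refl = inj₂ λ r≡b → other (refl , r≡b)
    ... | no s≢a   = inj₁ s≢a

~-swap-snoc : ∀ M m m' → (sender m ≢ sender m' ⊎ receiver m ≢ receiver m') →
  ((M ++ [ m ]) ++ [ m' ]) ~ ((M ++ [ m' ]) ++ [ m ])
~-swap-snoc M m m' apart =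
  subst₂ _~_ (sym (++-assoc M [ m ] [ m' ])) (sym (++-assoc M [ m' ] [ m ])) (≈Q⇒~ (qswap M [] m m' apart))

-- Global types as tree coalgebras

-- A step of a session removes a communication of G that need not be at
-- the root, so the reduct of a global type is not a subterm of it.
-- Global types are therefore viewed as coalgebras, and AfterCoalg C β
-- builds the reduct after the step β: a state inj₁ s still has to remove
-- the action of play β, a state inj₂ s is an untouched copy.
data Node (S : Set) : Set where
  nend  : Node S
  ncomm : Dir → Participant → Participant → (k : ℕ) → (Fin (suc k) → Label) → (Fin (suc k) → S) → Node S

mapNode : {S T : Set} → (S → T) → Node S → Node T
mapNode f nend = nend
mapNode f (ncomm d p q k lb kid) = ncomm d p q k lb (λ i → f (kid i))

record Coalg : Set₁ where
  field
    State : Set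
    obs   : State → Node State
open Coalg public

labelOf : Comm → Label
labelOf (cout _ _ l) = l
labelOf (cin _ _ l) = l

afterNode : (C : Coalg) → Comm → Node (State C) → Node (State C ⊎ State C)
afterNode C β nend = nend
afterNode C β (ncomm d p q k lb kid) with playOf d p q ≟ play β
... | no _ = ncomm d p q k lb (λ i → inj₁ (kid i))
... | yes _ with finAny? (λ i → lb i ≟ labelOf β)
...   | yes (i , _) = mapNode inj₂ (obs C (kid i))
...   | no _        = nend

afterObs : (C : Coalg) → Comm → State C ⊎ State C → Node (State C ⊎ State C)
afterObs C β (inj₁ s) = afterNode C β (obs C s)
afterObs C β (inj₂ s) = mapNode inj₂ (obs C s)

AfterCoalg : Coalg → Comm → Coalg
AfterCoalg C β = record { State = State C ⊎ State C ; obs = afterObs C β }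

afterNode-other : ∀ {C β d p q k lb kid} → playOf d p q ≢ play β →
  afterNode C β (ncomm d p q k lb kid) ≡ ncomm d p q k lb (λ i → inj₁ (kid i))
afterNode-other {β = β} {d} {p} {q} notβ with playOf d p q ≟ play β
... | yes isβ = ⊥-elim (notβ isβ)
... | no _    = refl

afterNode-player : ∀ {C β d p q k lb kid} → playOf d p q ≡ play β → ∀ i → lb i ≡ labelOf β →
  ∃[ i' ] (lb i' ≡ labelOf β × afterNode C β (ncomm d p q k lb kid) ≡ mapNode inj₂ (obs C (kid i')))
afterNode-player {β = β} {d} {p} {q} {lb = lb} isβ i li with playOf d p q ≟ play β
... | no notβ = ⊥-elim (notβ isβ)
... | yes _ with finAny? (λ i → lb i ≟ labelOf β)
...   | yes (i' , li') = i' , li' , refl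
...   | no none        = ⊥-elim (none (i , li))

NodeSatisfies : {S : Set} → (Dir → Participant → Participant → Set) → Node S → Set
NodeSatisfies P nend = ⊥
NodeSatisfies P (ncomm d p q _ _ _) = P d p q

NodeSatisfies-map : ∀ {S T : Set} {P} (f : S → T) (x : Node S) → NodeSatisfies P x → NodeSatisfies P (mapNode f x)
NodeSatisfies-map f (ncomm d p q k lb kid) h = h

PlayedBy : Participant → Dir → Participant → Participant → Set
PlayedBy z d p q = playOf d p q ≡ z

InputOn : Participant → Participant → Dir → Participant → Participant → Set
InputOn a b out p q = ⊥
InputOn a b inp p q = (p ≡ a) × (q ≡ b)

-- The depth of the paper's boundedness, restricted to the paths that
-- the queue allows.
data Eventually (C : Coalg) (P : Dir → Participant → Participant → Set) : ℕ → Node (State C) → Queue → Set where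
  now    : ∀ {B x M} → NodeSatisfies P x → Eventually C P (suc B) x M
  viaOut : ∀ {B p q k lb kid M} → (∀ i → Eventually C P B (obs C (kid i)) (M ++ [ msg p (lb i) q ])) →
           Eventually C P (suc B) (ncomm out p q k lb kid) M
  viaIn  : ∀ {B p q k lb kid M} → (∃[ h ] ∃[ M' ] (M ~ (msg p (lb h) q ∷ M'))) →
           (∀ i M' → M ~ (msg p (lb i) q ∷ M') → Eventually C P B (obs C (kid i)) M') →
           Eventually C P (suc B) (ncomm inp p q k lb kid) M

Eventually-mono : ∀ {C P B B' x M} → Eventually C P B x M → B ≤ B' → Eventually C P B' x M
Eventually-mono (now h) (s≤s _) = now h
Eventually-mono (viaOut ev) (s≤s le) = viaOut λ i → Eventually-mono (ev i) le
Eventually-mono (viaIn hd ev) (s≤s le) = viaIn hd λ i M' e → Eventually-mono (ev i M' e) le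

Eventually-~ : ∀ {C P B x M M'} → Eventually C P B x M → M ~ M' → Eventually C P B x M'
Eventually-~ (now h) e = now h
Eventually-~ (viaOut {p = p} {q = q} {lb = lb} ev) e = viaOut λ i → Eventually-~ (ev i) (~-++ [ msg p (lb i) q ] e)
Eventually-~ (viaIn (h , M₁ , e₁) ev) e = viaIn (h , M₁ , ~-trans (~-sym e) e₁) λ i M₂ e₂ → ev i M₂ (~-trans e e₂)

Eventually-hom : ∀ {C D P B x M} (f : State C → State D) → (∀ s → obs D (f s) ≡ mapNode f (obs C s)) →
  Eventually C P B x M → Eventually D P B (mapNode f x) M
Eventually-hom {x = x} f hom (now h) = now (NodeSatisfies-map f x h)
Eventually-hom {D = D} {P = P} {M = M} f hom (viaOut {B = B} {p = p} {q = q} {lb = lb} {kid = kid} ev) =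
  viaOut λ i → subst (λ z → Eventually D P B z (M ++ [ msg p (lb i) q ])) (sym (hom (kid i))) (Eventually-hom f hom (ev i))
Eventually-hom {D = D} {P = P} f hom (viaIn {B = B} {kid = kid} hd ev) =
  viaIn hd λ i M' e → subst (λ z → Eventually D P B z M') (sym (hom (kid i))) (Eventually-hom f hom (ev i M' e))

supFin : ∀ {k} → (Fin k → ℕ) → ℕ
supFin {zero} f = 0
supFin {suc k} f = f zero ⊔ supFin (λ i → f (suc i))

≤-supFin : ∀ {k} (f : Fin k → ℕ) i → f i ≤ supFin f
≤-supFin f zero = m≤m⊔n _ _
≤-supFin f (suc i) = ≤-trans (≤-supFin (λ j → f (suc j)) i) (m≤n⊔m _ _)

eventually-out : ∀ {C P p q k lb kid M} →
  (∀ (i : Fin (suc k)) → ∃[ B ] Eventually C P B (obs C (kid i)) (M ++ [ msg p (lb i) q ])) →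
  ∃[ B ] Eventually C P B (ncomm out p q k lb kid) M
eventually-out ev = suc (supFin bound) , viaOut λ i → Eventually-mono (proj₂ (ev i)) (≤-supFin bound i)
  where bound = λ i → proj₁ (ev i)

-- Only the children whose label heads channel p→q are reachable, so the
-- bound is the supremum over those (the others contribute 0).
eventually-in : ∀ {C P p q k lb kid M} →
  (∃[ h ] ∃[ M' ] (M ~ (msg p (lb h) q ∷ M'))) →
  (∀ (i : Fin (suc k)) M' → M ~ (msg p (lb i) q ∷ M') → ∃[ B ] Eventually C P B (obs C (kid i)) M') →
  ∃[ B ] Eventually C P B (ncomm inp p q k lb kid) M
eventually-in {C} {P} {p} {q} {k} {lb} {kid} {M} (h , M₀ , e₀) ev = suc (supFin bound) , viaIn (h , M₀ , e₀) child
  where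
  front : ∀ {i} → lb i ≡ lb h → M ~ (msg p (lb i) q ∷ dropChannel p q M)
  front e = ~∷⇒~∷dropChannel (subst (λ z → M ~ (msg p z q ∷ M₀)) (sym e) e₀)
  boundAt : ∀ i → Dec (lb i ≡ lb h) → ℕ
  boundAt i (yes e) = proj₁ (ev i _ (front e))
  boundAt i (no _)  = 0
  bound : Fin (suc k) → ℕ
  bound i = boundAt i (lb i ≟ lb h)
  childAt : ∀ i M' → M ~ (msg p (lb i) q ∷ M') → (d : Dec (lb i ≡ lb h)) → boundAt i d ≤ supFin bound →
            Eventually C P (supFin bound) (obs C (kid i)) M'
  childAt i M' e (yes e') le = Eventually-mono (Eventually-~ (proj₂ (ev i _ (front e'))) (proj₂ (~∷-unique (front e') e))) le
  childAt i M' e (no ne) _   = ⊥-elim (ne (sym (proj₁ (~∷-unique e₀ e))))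
  child : ∀ i M' → M ~ (msg p (lb i) q ∷ M') → Eventually C P (supFin bound) (obs C (kid i)) M'
  child i M' e = childAt i M' e (lb i ≟ lb h) (≤-supFin bound i)

infix 4 _≐_
_≐_ : Network → Network → Set
N ≐ N' = ∀ r → N r ≡ N' r

update-≡ : ∀ N p P → update N p P p ≡ P
update-≡ N p P with p ≟ p
... | yes _  = refl
... | no p≢p = ⊥-elim (p≢p refl)

update-≢ : ∀ N p P r → r ≢ p → update N p P r ≡ N r
update-≢ N p P r r≢p with r ≟ p
... | yes r≡p = ⊥-elim (r≢p r≡p)
... | no _    = refl

update-cong : ∀ {N N'} p P → N ≐ N' → update N p P ≐ update N' p P
update-cong p P e r with r ≟ p
... | yes _ = refl
... | no _  = e r

update-comm : ∀ N p A y B → p ≢ y → update (update N p A) y B ≐ update (update N y B) p A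
update-comm N p A y B n r = byTarget (r ≟ y) (r ≟ p)
  where
  byTarget : Dec (r ≡ y) → Dec (r ≡ p) → update (update N p A) y B r ≡ update (update N y B) p A r
  byTarget (yes refl) (yes refl) = ⊥-elim (n refl)
  byTarget (yes refl) (no b) = trans (update-≡ (update N p A) r B) (sym (trans (update-≢ (update N r B) p A r b) (update-≡ N r B)))
  byTarget (no a) (yes refl) = trans (update-≢ _ y B r a) (trans (update-≡ N r A) (sym (update-≡ _ r A)))
  byTarget (no a) (no b) = trans (update-≢ _ y B r a) (trans (update-≢ N p A r b) (sym (trans (update-≢ _ p A r b) (update-≢ N y B r a))))

-- The invariant: typing, balancing and finite depth

-- One unfolding of the typing rules (Out) and (In), where balancing
-- supplies a message at the head of the channel read by an input.
data InvNode (C : Coalg) (R : Node (State C) → Network → Queue → Set) : Node (State C) → Network → Queue → Set where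
  iEnd : ∀ {N M} → (∀ r → IsEnd (N r)) → M ~ [] → InvNode C R nend N M
  iOut : ∀ {N M p q k lb kid P} (pc : Choice (Fin (size P))) → N p ≡ P → pnode P ≡ pact out q pc →
    (∀ j → ∃[ i ] lb i ≡ lab pc j) → (∀ i → ∃[ j ] lb i ≡ lab pc j) →
    (∀ i j → lb i ≡ lab pc j → R (obs C (kid i)) (update N p (goto P (cont pc j))) (M ++ [ msg p (lb i) q ])) →
    InvNode C R (ncomm out p q k lb kid) N M
  iIn : ∀ {N M p q k lb kid P} (pc : Choice (Fin (size P))) → N q ≡ P → pnode P ≡ pact inp p pc →
    (∃[ h ] ∃[ M' ] (M ~ (msg p (lb h) q ∷ M'))) → (∀ i → ∃[ j ] lb i ≡ lab pc j) →
    (∀ i j M' → lb i ≡ lab pc j → M ~ (msg p (lb i) q ∷ M') → R (obs C (kid i)) (update N q (goto P (cont pc j))) M') →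
    InvNode C R (ncomm inp p q k lb kid) N M

-- Measure is what boundedness and balancing contribute; it is the
-- quantity that decreases under lockstep steps.
Measure : (C : Coalg) → Node (State C) → Network → Queue → Set
Measure C x N M = (∀ z → InPlaysN N z → ∃[ B ] Eventually C (PlayedBy z) B x M)
                × (∀ a l b M' → M ~ (msg a l b ∷ M') → ∃[ B ] Eventually C (InputOn a b) B x M)

-- Inv is the greatest fixed point of InvNode with Measure imposed at
-- every node, given by its finite approximants InvUpTo k.
InvUpTo : ℕ → (C : Coalg) → Node (State C) → Network → Queue → Set
InvUpTo zero C x N M = ⊤
InvUpTo (suc k) C x N M = InvNode C (InvUpTo k C) x N M × Measure C x N M

Inv : (C : Coalg) → Node (State C) → Network → Queue → Set
Inv C x N M = ∀ k → InvUpTo k C x N M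

Measure-resp : ∀ {C x N N' M M'} → Measure C x N M → N ≐ N' → M ~ M' → Measure C x N' M'
Measure-resp (players , channels) eN eM =
  (λ z a → let (B , e) = players z (λ ie → a (subst IsEnd (eN z) ie)) in B , Eventually-~ e eM) ,
  (λ a l b M₂ e → let (B , ev) = channels a l b M₂ (~-trans eM e) in B , Eventually-~ ev eM)

InvUpTo-resp : ∀ k {C x N N' M M'} → InvUpTo k C x N M → N ≐ N' → M ~ M' → InvUpTo k C x N' M'
InvUpTo-resp zero _ _ _ = tt
InvUpTo-resp (suc k) (iEnd allEnd empty , measure) eN eM =
  iEnd (λ r → subst IsEnd (eN r) (allEnd r)) (~-trans (~-sym eM) empty) , Measure-resp measure eN eM
InvUpTo-resp (suc k) {N = N} {N'} (iOut {p = p} {q = q} {lb = lb} pc atP en toGlobal toProc children , measure) eN eM =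
  iOut pc (trans (sym (eN p)) atP) en toGlobal toProc
    (λ i j e → InvUpTo-resp k (children i j e) (update-cong p _ eN) (~-++ [ msg p (lb i) q ] eM)) ,
  Measure-resp measure eN eM
InvUpTo-resp (suc k) {N = N} {N'} (iIn {q = q} pc atP en (h , M₁ , allEnd) toProc children , measure) eN eM =
  iIn pc (trans (sym (eN q)) atP) en (h , M₁ , ~-trans (~-sym eM) allEnd) toProc
    (λ i j M₂ e e₂ → InvUpTo-resp k (children i j M₂ e (~-trans eM e₂)) (update-cong q _ eN) ~-refl) ,
  Measure-resp measure eN eM

InvUpTo-hom : ∀ k {C D x N M} (f : State C → State D) → (∀ s → obs D (f s) ≡ mapNode f (obs C s)) →
  InvUpTo k C x N M → InvUpTo k D (mapNode f x) N M
InvUpTo-hom zero f hom _ = tt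
InvUpTo-hom (suc k) {C} {D} {x} f hom (unfolded , players , channels) = unfold unfolded ,
  (λ z a → let (B , e) = players z a in B , Eventually-hom f hom e) ,
  (λ a l b M₂ e → let (B , ev) = channels a l b M₂ e in B , Eventually-hom f hom ev)
  where
  unfold : ∀ {x N M} → InvNode C (InvUpTo k C) x N M → InvNode D (InvUpTo k D) (mapNode f x) N M
  unfold (iEnd allEnd empty) = iEnd allEnd empty
  unfold {M = M} (iOut {N = N} {p = p} {q = q} {lb = lb} {kid = kid} {P = P} pc atP en toGlobal toProc children) =
    iOut pc atP en toGlobal toProc λ i j e →
      subst (λ z → InvUpTo k D z (update N p (goto P (cont pc j))) (M ++ [ msg p (lb i) q ])) (sym (hom (kid i)))
        (InvUpTo-hom k f hom (children i j e))
  unfold (iIn {N = N} {q = q} {kid = kid} {P = P} pc atP en head toProc children) =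
    iIn pc atP en head toProc λ i j M₂ e e₂ →
      subst (λ z → InvUpTo k D z (update N q (goto P (cont pc j))) M₂) (sym (hom (kid i)))
        (InvUpTo-hom k f hom (children i j M₂ e e₂))


module _ {C : Coalg} where

  Inv-measure : ∀ {x N M} → Inv C x N M → Measure C x N M
  Inv-measure I = proj₂ (I 1)

  Inv-end : ∀ {N M} → Inv C nend N M → (∀ r → IsEnd (N r)) × M ~ []
  Inv-end I with I 1
  ... | iEnd allEnd empty , _ = allEnd , empty

  Inv-out : ∀ {p q k lb kid N M} → Inv C (ncomm out p q k lb kid) N M →
    Σ (Choice (Fin (size (N p)))) λ pc → pnode (N p) ≡ pact out q pc ×
      (∀ j → ∃[ i ] lb i ≡ lab pc j) × (∀ i → ∃[ j ] lb i ≡ lab pc j)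
  Inv-out I with I 1
  ... | iOut pc refl en toGlobal toProc _ , _ = pc , en , toGlobal , toProc

  InvUpTo-childOut : ∀ k {p q k' lb kid N M} → InvUpTo (suc k) C (ncomm out p q k' lb kid) N M →
    (pc : Choice (Fin (size (N p)))) → pnode (N p) ≡ pact out q pc → ∀ i j → lb i ≡ lab pc j →
    InvUpTo k C (obs C (kid i)) (update N p (goto (N p) (cont pc j))) (M ++ [ msg p (lb i) q ])
  InvUpTo-childOut k (iOut pc′ refl en′ toGlobal toProc children , _) pc en i j e with trans (sym en) en′
  ... | refl = children i j e

  Inv-childOut : ∀ {p q k' lb kid N M} → Inv C (ncomm out p q k' lb kid) N M →
    (pc : Choice (Fin (size (N p)))) → pnode (N p) ≡ pact out q pc → ∀ i j → lb i ≡ lab pc j →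
    Inv C (obs C (kid i)) (update N p (goto (N p) (cont pc j))) (M ++ [ msg p (lb i) q ])
  Inv-childOut I pc en i j e k = InvUpTo-childOut k (I (suc k)) pc en i j e

  Inv-in : ∀ {a b k lb kid N M} → Inv C (ncomm inp a b k lb kid) N M →
    Σ (Choice (Fin (size (N b)))) λ pc → pnode (N b) ≡ pact inp a pc ×
      (∃[ h ] ∃[ M' ] (M ~ (msg a (lb h) b ∷ M'))) × (∀ i → ∃[ j ] lb i ≡ lab pc j)
  Inv-in I with I 1
  ... | iIn pc refl en head toProc _ , _ = pc , en , head , toProc

  InvUpTo-childIn : ∀ k {a b k' lb kid N M} → InvUpTo (suc k) C (ncomm inp a b k' lb kid) N M →
    (pc : Choice (Fin (size (N b)))) → pnode (N b) ≡ pact inp a pc → ∀ i j M' → lb i ≡ lab pc j →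
    M ~ (msg a (lb i) b ∷ M') →
    InvUpTo k C (obs C (kid i)) (update N b (goto (N b) (cont pc j))) M'
  InvUpTo-childIn k (iIn pc′ refl en′ head toProc children , _) pc en i j M' e e' with trans (sym en) en′
  ... | refl = children i j M' e e'

  Inv-childIn : ∀ {a b k' lb kid N M} → Inv C (ncomm inp a b k' lb kid) N M →
    (pc : Choice (Fin (size (N b)))) → pnode (N b) ≡ pact inp a pc → ∀ i j M' → lb i ≡ lab pc j →
    M ~ (msg a (lb i) b ∷ M') →
    Inv C (obs C (kid i)) (update N b (goto (N b) (cont pc j))) M'
  Inv-childIn I pc en i j M' e e' k = InvUpTo-childIn k (I (suc k)) pc en i j M' e e'

  Inv-resp : ∀ {x N N' M M'} → Inv C x N M → N ≐ N' → M ~ M' → Inv C x N' M'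
  Inv-resp I eN eM k = InvUpTo-resp k (I k) eN eM

-- Step up to ≐ and ~, so that it can be transported along the
-- rearrangements of network and queue made by subject reduction.
data StepData (N : Network) (M : Queue) : Comm → Network → Queue → Set where
  sdOut : ∀ {p q l P N' M'} (pc : Choice (Fin (size P))) → N p ≡ P → pnode P ≡ pact out q pc →
    (h : Fin (suc (n pc))) → lab pc h ≡ l → update N p (goto P (cont pc h)) ≐ N' → (M ++ [ msg p l q ]) ~ M' →
    StepData N M (cout p q l) N' M'
  sdIn : ∀ {p q l P N' M'} (pc : Choice (Fin (size P))) → N q ≡ P → pnode P ≡ pact inp p pc →
    (h : Fin (suc (n pc))) → lab pc h ≡ l → M ~ (msg p l q ∷ M') → update N q (goto P (cont pc h)) ≐ N' →
    StepData N M (cin p q l) N' M'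

StepMatches : Comm → Dir → Participant → Participant → Set
StepMatches (cout y z _) d s r = (d ≡ out) × (r ≡ z)
StepMatches (cin p y _) d s r = (d ≡ inp) × (s ≡ p)

Step⇒StepData : ∀ {N M β N' M'} → Step (N , M) β (N' , M') → StepData N M β N' M'
Step⇒StepData (stOut en h) = sdOut _ refl en h refl (λ r → refl) ~-refl
Step⇒StepData (stIn en h e) = sdIn _ refl en h refl (≈Q⇒~ e) (λ r → refl)

StepData-active : ∀ {N M β N' M'} → StepData N M β N' M' → ¬ IsEnd (N (play β))
StepData-active (sdOut pc refl en h _ _ _) end with trans (sym end) en
... | ()
StepData-active (sdIn pc refl en h _ _ _) end with trans (sym end) en
... | ()

StepData-other : ∀ {N M β N' M'} → StepData N M β N' M' → ∀ r → r ≢ play β → N' r ≡ N r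
StepData-other (sdOut {p = p} pc eP en h _ eN eM) r notβ = trans (sym (eN r)) (update-≢ _ p _ r notβ)
StepData-other (sdIn {q = q} pc eP en h _ eM eN) r notβ = trans (sym (eN r)) (update-≢ _ q _ r notβ)

StepData-afterOut : ∀ {N M β N' M' p l q} X → StepData N M β N' M' → p ≢ play β →
  StepData (update N p X) (M ++ [ msg p l q ]) β (update N' p X) (M' ++ [ msg p l q ])
StepData-afterOut {N} {M} {p = p} {l} {q} X (sdOut {p = y} {q = z} {l = l'} pc eP en h el eN eM) notβ =
  sdOut pc (trans (update-≢ N p X y (≢-sym notβ)) eP) en h el
    (λ r → trans (update-comm N p X y _ notβ r) (update-cong p X eN r))
    (~-trans (~-swap-snoc M (msg p l q) (msg y l' z) (inj₁ notβ)) (~-++ [ msg p l q ] eM))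
StepData-afterOut {N} {M} {p = p} {l} {q} X (sdIn {p = a} {q = y} pc eP en h el eM eN) notβ =
  sdIn pc (trans (update-≢ N p X y (≢-sym notβ)) eP) en h el (~-++ [ msg p l q ] eM)
    (λ r → trans (update-comm N p X y _ notβ r) (update-cong p X eN r))

StepData-afterIn : ∀ {N M β N' M' a l b M₂} X → StepData N M β N' M' → b ≢ play β →
  M ~ (msg a l b ∷ M₂) → ∀ M₃ → M' ~ (msg a l b ∷ M₃) →
  StepData (update N b X) M₂ β (update N' b X) M₃
StepData-afterIn {N} {M} {b = b} X (sdOut {p = y} {q = z} {l = l'} pc eP en h el eN eM) notβ e M₃ e₃ =
  sdOut pc (trans (update-≢ N b X y (≢-sym notβ)) eP) en h el
    (λ r → trans (update-comm N b X y _ notβ r) (update-cong b X eN r))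
    (proj₂ (~∷-unique (~-++ [ msg y l' z ] e) (~-trans eM e₃)))
StepData-afterIn {N} {M} {b = b} X (sdIn {p = a'} {q = y} pc eP en h el eM eN) notβ e M₃ e₃ =
  sdIn pc (trans (update-≢ N b X y (≢-sym notβ)) eP) en h el
    (~∷-swap (λ c → notβ (sym (proj₂ c))) eM e e₃)
    (λ r → trans (update-comm N b X y _ notβ r) (update-cong b X eN r))

StepData-head : ∀ {N M β N' M' a l b M₂} → StepData N M β N' M' → b ≢ play β →
  M ~ (msg a l b ∷ M₂) → M' ~ (msg a l b ∷ dropChannel a b M')
StepData-head (sdOut {p = y} {q = z} {l = l'} pc eP en h el eN eM) notβ e = ~∷⇒~∷dropChannel (~-trans (~-sym eM) (~-++ [ msg y l' z ] e))
StepData-head (sdIn pc eP en h el eM eN) notβ e = ~∷-other (λ c → notβ (sym (proj₂ c))) eM e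

Successor : Dir → Participant → Participant → ∀ {k} → (Fin (suc k) → Label) → Fin (suc k) → Queue → Queue → Set
Successor out s r lb i M M' = (M ++ [ msg s (lb i) r ]) ~ M'
Successor inp s r lb i M M' = M ~ (msg s (lb i) r ∷ M')

Inv-player : ∀ {C d s r k lb kid N M β N' M'} → Inv C (ncomm d s r k lb kid) N M → playOf d s r ≡ play β →
  StepData N M β N' M' →
  (∃[ i ] lb i ≡ labelOf β) ×
  (∀ i → lb i ≡ labelOf β → Inv C (obs C (kid i)) N' M' × Successor d s r lb i M M') × StepMatches β d s r
Inv-player {d = out} {s} {r} {M = M} I refl (sdOut pc refl en' h refl eN eM) with Inv-out I
... | _ , en , toGlobal , _ with trans (sym en) en'
...   | refl = toGlobal h , (λ i e → let e' = subst (λ z → (M ++ [ msg s z r ]) ~ _) (sym e) eM in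
                                   Inv-resp (Inv-childOut I pc en i h e) eN e' , e') , refl , refl
Inv-player {d = out} I refl (sdIn pc refl en' h _ eM eN) with Inv-out I
... | _ , en , _ with trans (sym en) en'
...   | ()
Inv-player {d = inp} I refl (sdOut pc refl en' h _ eN eM) with Inv-in I
... | _ , en , _ , _ with trans (sym en) en'
...   | ()
Inv-player {d = inp} {a} {b} {M = M} I refl (sdIn pc refl en' h refl eM eN) with Inv-in I
... | _ , en , (h₀ , M₀ , e₀) , _ with trans (sym en) en'
...   | refl = (h₀ , proj₁ (~∷-unique e₀ eM)) ,
               (λ i e → let e' = subst (λ z → M ~ (msg a z b ∷ _)) (sym e) eM in
                        Inv-resp (Inv-childIn I pc en i h _ e e') eN ~-refl , e') , refl , refl

-- Subject reduction

Avoids : (Dir → Participant → Participant → Set) → Comm → Set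
Avoids P β = ∀ d s r → playOf d s r ≡ play β → StepMatches β d s r → ¬ P d s r

StepData-pastInput : ∀ {N M β N' M' a l l' b M₀ M₃} → StepData N M β N' M' → b ≢ play β →
  M ~ (msg a l b ∷ M₀) → M' ~ (msg a l' b ∷ M₃) →
  M ~ (msg a l' b ∷ dropChannel a b M) × (∀ X → StepData (update N b X) (dropChannel a b M) β (update N' b X) M₃)
StepData-pastInput {M = M} {a = a} {b = b} {M₀ = M₀} sd notβ e₀ e₃ =
  front , λ X → StepData-afterIn X sd notβ front _ e₃
  where
  front = ~∷⇒~∷dropChannel (subst (λ z → M ~ (msg a z b ∷ M₀)) (proj₁ (~∷-unique (StepData-head sd notβ e₀) e₃)) e₀)

Eventually-child : ∀ {C P B d s r k lb kid M} → Eventually C P (suc B) (ncomm d s r k lb kid) M → ¬ P d s r →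
  ∀ i M' → Successor d s r lb i M M' → Eventually C P B (obs C (kid i)) M'
Eventually-child (now h) notP i M' next = ⊥-elim (notP h)
Eventually-child (viaOut ev) notP i M' next = Eventually-~ (ev i) next
Eventually-child (viaIn _ ev) notP i M' next = ev i M' next

Eventually-after-root : ∀ {C P B d s r k lb kid N M β N' M'} → Inv C (ncomm d s r k lb kid) N M →
  StepData N M β N' M' → playOf d s r ≡ play β → ¬ P d s r →
  Eventually C P (suc B) (ncomm d s r k lb kid) M → Eventually (AfterCoalg C β) P B (afterNode C β (ncomm d s r k lb kid)) M'
Eventually-after-root {C} {P} {B} {d} {s} {r} {k} {lb} {kid} {β = β} {M' = M'} I sd isβ notP ev with Inv-player I isβ sd
... | (i , li) , child , _ with afterNode-player {C = C} {β = β} {d} {s} {r} {k} {lb} {kid} isβ i li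
...   | i' , li' , reduct = subst (λ z → Eventually (AfterCoalg C β) P B z M') (sym reduct)
          (Eventually-hom inj₂ (λ _ → refl) (Eventually-child ev notP i' M' (proj₂ (child i' li'))))

Eventually-after : ∀ {C P B x N M β N' M'} → Avoids P β → Eventually C P B x M → Inv C x N M →
  StepData N M β N' M' → Eventually (AfterCoalg C β) P B (afterNode C β x) M'

Eventually-after-other : ∀ {C P B d s r k lb kid N M β N' M'} → Avoids P β →
  Eventually C P B (ncomm d s r k lb kid) M → Inv C (ncomm d s r k lb kid) N M →
  StepData N M β N' M' → playOf d s r ≢ play β →
  Eventually (AfterCoalg C β) P B (ncomm d s r k lb (λ i → inj₁ (kid i))) M'
Eventually-after-other avoid (now h) I sd notβ = now h
Eventually-after-other {N = N} avoid (viaOut ev) I sd notβ with Inv-out I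
... | pc , en , _ , toProc = viaOut λ i → let (j , e) = toProc i in
      Eventually-after avoid (ev i) (Inv-childOut I pc en i j e) (StepData-afterOut (goto (N _) (cont pc j)) sd notβ)
Eventually-after-other {N = N} avoid (viaIn _ ev) I sd notβ with Inv-in I
... | pc , en , (_ , _ , e₀) , toProc = viaIn (_ , _ , StepData-head sd notβ e₀) λ i M₃ e₃ →
      let (j , e) = toProc i
          (front , past) = StepData-pastInput sd notβ e₀ e₃
      in Eventually-after avoid (ev i _ front) (Inv-childIn I pc en i j _ e front) (past (goto (N _) (cont pc j)))

Eventually-after {x = nend} avoid (now ()) I sd
Eventually-after {C} {P} {x = ncomm d s r k lb kid} {β = β} {M' = M'} avoid ev I sd = byPlayer (playOf d s r ≟ play β)
  where
  byPlayer : Dec (playOf d s r ≡ play β) → Eventually (AfterCoalg C β) P _ (afterNode C β (ncomm d s r k lb kid)) M'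
  byPlayer (no notβ) = subst (λ z → Eventually (AfterCoalg C β) P _ z M') (sym (afterNode-other {C = C} {β = β} {d} {s} {r} {k} {lb} {kid} notβ))
                         (Eventually-after-other avoid ev I sd notβ)
  byPlayer (yes isβ) = Eventually-after-root I sd isβ (avoid _ _ _ isβ (proj₂ (proj₂ (Inv-player I isβ sd))))
                         (Eventually-mono ev (n≤1+n _))

-- Until play β acts, β is still pending below the current node.  R records
-- what is known there (the local state of play β, or a channel), is kept
-- by the other participants' actions, and settle turns it into a bound
-- once the node of β is reached.
Eventually-after-pending : ∀ {C P B x N M β N' M'} (R : Network → Queue → Set) →
  (∀ {N M p l q X} → R N M → p ≢ play β → R (update N p X) (M ++ [ msg p l q ])) →
  (∀ {N M a l b M₂ X} → R N M → b ≢ play β → M ~ (msg a l b ∷ M₂) → R (update N b X) M₂) →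
  (∀ {x' N₂ M₂ N₂' M₂'} → R N₂ M₂ → StepData N₂ M₂ β N₂' M₂' → Inv C x' N₂' M₂' → ∃[ B ] Eventually C P B x' M₂') →
  Eventually C (PlayedBy (play β)) B x M → Inv C x N M → StepData N M β N' M' → R N M →
  ∃[ B' ] Eventually (AfterCoalg C β) P B' (afterNode C β x) M'
Eventually-after-pending {x = nend} R keepOut keepIn settle (now ()) I sd rNM
Eventually-after-pending {C} {P} {x = ncomm d s r k lb kid} {N} {M} {β} {M' = M'} R keepOut keepIn settle ev I sd rNM =
  byPlayer (playOf d s r ≟ play β)
  where
  C′ = AfterCoalg C β
  Goal = ∃[ B' ] Eventually C′ P B' (afterNode C β (ncomm d s r k lb kid)) M'
  atβ : playOf d s r ≡ play β → (∃[ i ] lb i ≡ labelOf β) →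
        (∀ i → lb i ≡ labelOf β → Inv C (obs C (kid i)) _ M' × _) → Goal
  atβ isβ (i , li) child with afterNode-player {C = C} {β = β} {d} {s} {r} {k} {lb} {kid} isβ i li
  ... | i' , li' , reduct with settle rNM sd (proj₁ (child i' li'))
  ...   | B , ev' = B , subst (λ z → Eventually C′ P B z M') (sym reduct) (Eventually-hom inj₂ (λ _ → refl) ev')
  below : ∀ {B} → playOf d s r ≢ play β → Eventually C (PlayedBy (play β)) B (ncomm d s r k lb kid) M →
          ∃[ B' ] Eventually C′ P B' (ncomm d s r k lb (λ i → inj₁ (kid i))) M'
  below notβ (now isβ) = ⊥-elim (notβ isβ)
  below notβ (viaOut ev) with Inv-out I
  ... | pc , en , _ , toProc = eventually-out {C = C′} {lb = lb} λ i → let (j , e) = toProc i in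
        Eventually-after-pending R keepOut keepIn settle (ev i) (Inv-childOut I pc en i j e)
          (StepData-afterOut (goto (N s) (cont pc j)) sd notβ) (keepOut rNM notβ)
  below notβ (viaIn _ ev) with Inv-in I
  ... | pc , en , (_ , _ , e₀) , toProc = eventually-in {C = C′} {lb = lb} (_ , _ , StepData-head sd notβ e₀) λ i M₃ e₃ →
        let (j , e) = toProc i
            (front , past) = StepData-pastInput sd notβ e₀ e₃
        in Eventually-after-pending R keepOut keepIn settle (ev i _ front) (Inv-childIn I pc en i j _ e front)
             (past (goto (N r) (cont pc j))) (keepIn rNM notβ front)
  byPlayer : Dec (playOf d s r ≡ play β) → Goal
  byPlayer (yes isβ) = let (found , child , _) = Inv-player I isβ sd in atβ isβ found child
  byPlayer (no notβ) = let (B , ev') = below notβ ev in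
                       B , subst (λ z → Eventually C′ P B z M') (sym (afterNode-other {C = C} {β = β} {d} {s} {r} {k} {lb} {kid} notβ)) ev'

StepData-next : ∀ {N M β N' M' N₂ M₂ N₂' M₂'} → StepData N M β N' M' → StepData N₂ M₂ β N₂' M₂' →
  N₂ (play β) ≡ N (play β) → N₂' (play β) ≡ N' (play β)
StepData-next {N} {N₂ = N₂} (sdOut {p = p} pc eP en h el eN _) (sdOut pc₂ eP₂ en₂ h₂ el₂ eN₂ _) same
  with trans (sym eP₂) (trans same eP)
... | refl with trans (sym en) en₂
...   | refl with distinct pc (trans el (sym el₂))
...     | refl = trans (sym (eN₂ p)) (trans (update-≡ N₂ p _) (trans (sym (update-≡ N p _)) (eN p)))
StepData-next {N} {N₂ = N₂} (sdIn {q = q} pc eP en h el _ eN) (sdIn pc₂ eP₂ en₂ h₂ el₂ _ eN₂) same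
  with trans (sym eP₂) (trans same eP)
... | refl with trans (sym en) en₂
...   | refl with distinct pc (trans el (sym el₂))
...     | refl = trans (sym (eN₂ q)) (trans (update-≡ N₂ q _) (trans (sym (update-≡ N q _)) (eN q)))

Measure-after-player : ∀ {C x N M β N' M'} → Inv C x N M → StepData N M β N' M' →
  ∀ z → InPlaysN N' z → ∃[ B ] Eventually (AfterCoalg C β) (PlayedBy z) B (afterNode C β x) M'
Measure-after-player {N = N} {β = β} I sd z active with z ≟ play β
... | no notβ = let (B , ev) = proj₁ (Inv-measure I) z (λ end → active (subst IsEnd (sym (StepData-other sd z notβ)) end))
                in B , Eventually-after (λ d s r isβ _ isz → notβ (trans (sym isz) isβ)) ev I sd
... | yes refl = Eventually-after-pending (λ N₂ _ → N₂ z ≡ N z)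
      (λ {N₂} {p = p} {X = X} same notβ → trans (update-≢ N₂ p X z (≢-sym notβ)) same)
      (λ {N₂} {b = b} {X = X} same notβ _ → trans (update-≢ N₂ b X z (≢-sym notβ)) same)
      (λ same sd₂ I₂ → proj₁ (Inv-measure I₂) z (λ end → active (subst IsEnd (StepData-next sd sd₂ same) end)))
      (proj₂ (proj₁ (Inv-measure I) z (StepData-active sd))) I sd refl

-- If a→b was empty before the output β fills it, the input of the new
-- message is pending: the channel stays empty until play β sends.
Measure-after-output : ∀ {C x N M p q l N' M' a l' b M₂} → Inv C x N M → StepData N M (cout p q l) N' M' →
  M' ~ (msg a l' b ∷ M₂) → ∃[ B ] Eventually (AfterCoalg C (cout p q l)) (InputOn a b) B (afterNode C (cout p q l) x) M'
Measure-after-output {C} {M = M} {p} {q} {l} {M' = M'} {a = a} {l'} {b} {M₂} I sd@(sdOut _ _ _ _ _ _ eM) e = byOldHead (labelsOn a b M) refl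
  where
  byOldHead : ∀ L → labelsOn a b M ≡ L → ∃[ B ] Eventually _ (InputOn a b) B _ _
  byOldHead (l₀ ∷ L) onab = let (B , ev) = proj₂ (Inv-measure I) a l₀ b _ (head⇒~∷dropChannel onab)
                            in B , Eventually-after (λ { d s r _ (refl , _) () }) ev I sd
  byOldHead [] onab = sent (sameChannel? p q a b)
    where
    onSent : labelsOn a b [ msg p l q ] ≡ l' ∷ labelsOn a b M₂
    onSent = begin
      labelsOn a b [ msg p l q ]                    ≡⟨ cong (_++ labelsOn a b [ msg p l q ]) onab ⟨
      labelsOn a b M ++ labelsOn a b [ msg p l q ]   ≡⟨ labelsOn-++ a b M _ ⟨
      labelsOn a b (M ++ [ msg p l q ])             ≡⟨ onChannel eM a b ⟩
      labelsOn a b M'                               ≡⟨ proj₁ (~∷⇒HeadIs e) ⟩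
      l' ∷ labelsOn a b M₂                          ∎
    emptyAfterInput : ∀ {M₃ a₂ l₂ b₂ M₄} → labelsOn p q M₃ ≡ [] → M₃ ~ (msg a₂ l₂ b₂ ∷ M₄) → labelsOn p q M₄ ≡ []
    emptyAfterInput {a₂ = a₂} {b₂ = b₂} empty e₂ with sameChannel? a₂ b₂ p q
    ... | yes (refl , refl) with trans (sym empty) (proj₁ (~∷⇒HeadIs e₂))
    ...   | ()
    emptyAfterInput empty e₂ | no other = trans (sym (proj₂ (~∷⇒HeadIs e₂) _ _ other)) empty
    settle : ∀ {x' N₂ M₃ N₂' M₃'} → labelsOn p q M₃ ≡ [] → StepData N₂ M₃ (cout p q l) N₂' M₃' → Inv C x' N₂' M₃' →
             ∃[ B ] Eventually C (InputOn p q) B x' M₃'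
    settle {M₃ = M₃} empty (sdOut _ _ _ _ _ _ eM₂) I₂ =
      proj₂ (Inv-measure I₂) p l q _ (head⇒~∷dropChannel (trans (sym (onChannel eM₂ p q))
        (trans (labelsOn-++ p q M₃ _) (trans (cong (_++ labelsOn p q [ msg p l q ]) empty) (labelsOn-head p q l [])))))
    sent : Dec (SameChannel p q a b) → ∃[ B ] Eventually _ (InputOn a b) B _ M'
    sent (no other) with trans (sym (labelsOn-skip {l = l} {X = []} other)) onSent
    ... | ()
    sent (yes (refl , refl)) = Eventually-after-pending (λ _ M₃ → labelsOn p q M₃ ≡ [])
      (λ {M = M₃} {p = p'} {l₂} {q'} empty notβ → trans (labelsOn-++ p q M₃ _)
         (trans (cong (_++ labelsOn p q [ msg p' l₂ q' ]) empty) (labelsOn-skip {l = l₂} {X = []} (λ same → notβ (proj₁ same)))))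
      (λ empty _ e₂ → emptyAfterInput empty e₂)
      settle (proj₂ (proj₁ (Inv-measure I) p (StepData-active sd))) I sd onab

-- If the input β consumes from a→b itself, the next message on a→b is
-- read by the next input of play β, which is pending.
Measure-after-input : ∀ {C x N M p q l N' M' a l' b M₂} → Inv C x N M → StepData N M (cin p q l) N' M' →
  M' ~ (msg a l' b ∷ M₂) → ∃[ B ] Eventually (AfterCoalg C (cin p q l)) (InputOn a b) B (afterNode C (cin p q l) x) M'
Measure-after-input {C} {p = p} {q} {l} {a = a} {l'} {b} {M₂} I sd@(sdIn _ _ _ _ _ eM _) e = consumed (sameChannel? p q a b)
  where
  TwoQueued : Queue → Set
  TwoQueued M₃ = ∃[ l₁ ] ∃[ l₂ ] ∃[ L ] (labelsOn p q M₃ ≡ l₁ ∷ l₂ ∷ L)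
  settle : ∀ {x' N₂ M₃ N₂' M₃'} → TwoQueued M₃ → StepData N₂ M₃ (cin p q l) N₂' M₃' → Inv C x' N₂' M₃' →
           ∃[ B ] Eventually C (InputOn p q) B x' M₃'
  settle (l₁ , l₂ , L , two) (sdIn _ _ _ _ _ eM₂ _) I₂ =
    proj₂ (Inv-measure I₂) p l₂ q _ (head⇒~∷dropChannel (proj₂ (∷-injective (trans (sym (proj₁ (~∷⇒HeadIs eM₂))) two))))
  consumed : Dec (SameChannel p q a b) → ∃[ B ] Eventually _ (InputOn a b) B _ _
  consumed (no other) =
    let (B , ev) = proj₂ (Inv-measure I) a l' b _ (head⇒~∷dropChannel (trans (proj₂ (~∷⇒HeadIs eM) a b other) (proj₁ (~∷⇒HeadIs e))))
    in B , Eventually-after (λ { d s r isβ (refl , refl) (refl , refl) → other (refl , sym isβ) }) ev I sd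
  consumed (yes (refl , refl)) = Eventually-after-pending (λ _ → TwoQueued)
    (λ {M = M₃} {p = p'} {l₂} {q'} (l₁ , l₃ , L , two) _ →
       l₁ , l₃ , L ++ labelsOn p q [ msg p' l₂ q' ] , trans (labelsOn-++ p q M₃ _) (cong (_++ labelsOn p q [ msg p' l₂ q' ]) two))
    (λ (l₁ , l₃ , L , two) notβ e₂ → l₁ , l₃ , L , trans (sym (proj₂ (~∷⇒HeadIs e₂) p q λ same → notβ (proj₂ same))) two)
    settle (proj₂ (proj₁ (Inv-measure I) q (StepData-active sd))) I sd
    (l , l' , labelsOn p q M₂ , trans (proj₁ (~∷⇒HeadIs eM)) (cong (l ∷_) (proj₁ (~∷⇒HeadIs e))))

Measure-after : ∀ {C x N M β N' M'} → Inv C x N M → StepData N M β N' M' →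
  Measure (AfterCoalg C β) (afterNode C β x) N' M'
Measure-after I sd@(sdOut _ _ _ _ _ _ _) = Measure-after-player I sd , λ _ _ _ _ → Measure-after-output I sd
Measure-after I sd@(sdIn _ _ _ _ _ _ _)  = Measure-after-player I sd , λ _ _ _ _ → Measure-after-input I sd

InvUpTo-after : ∀ k {C x N M β N' M'} → Inv C x N M → StepData N M β N' M' →
  InvUpTo k (AfterCoalg C β) (afterNode C β x) N' M'
InvUpTo-after zero I sd = tt
InvUpTo-after (suc k) {x = nend} I sd = ⊥-elim (StepData-active sd (proj₁ (Inv-end I) _))
InvUpTo-after (suc k) {C} {x = ncomm d s r k' lb kid} {N} {M} {β} {N'} {M'} I sd = byPlayer (playOf d s r ≟ play β)
  where
  C′ = AfterCoalg C β
  atβ : playOf d s r ≡ play β → (∃[ i ] lb i ≡ labelOf β) → (∀ i → lb i ≡ labelOf β → Inv C (obs C (kid i)) N' M' × _) →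
        InvUpTo (suc k) C′ (afterNode C β (ncomm d s r k' lb kid)) N' M'
  atβ isβ (i , li) child with afterNode-player {C = C} {β = β} {d} {s} {r} {k'} {lb} {kid} isβ i li
  ... | i' , li' , reduct = subst (λ z → InvUpTo (suc k) C′ z N' M') (sym reduct)
          (InvUpTo-hom (suc k) inj₂ (λ _ → refl) (proj₁ (child i' li') (suc k)))
  unfold : playOf d s r ≢ play β → ∀ d' → d' ≡ d → InvNode C′ (InvUpTo k C′) (ncomm d s r k' lb (λ i → inj₁ (kid i))) N' M'
  unfold notβ out refl with Inv-out I
  ... | pc , en , toGlobal , toProc = iOut pc (StepData-other sd s notβ) en toGlobal toProc λ i j e →
          InvUpTo-after k (Inv-childOut I pc en i j e) (StepData-afterOut (goto (N s) (cont pc j)) sd notβ)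
  unfold notβ inp refl with Inv-in I
  ... | pc , en , (_ , _ , e₀) , toProc = iIn pc (StepData-other sd r notβ) en (_ , _ , StepData-head sd notβ e₀) toProc
          λ i j M₃ e e₃ → let (front , past) = StepData-pastInput sd notβ e₀ e₃ in
            InvUpTo-after k (Inv-childIn I pc en i j _ e front) (past (goto (N r) (cont pc j)))
  byPlayer : Dec (playOf d s r ≡ play β) → InvUpTo (suc k) C′ (afterNode C β (ncomm d s r k' lb kid)) N' M'
  byPlayer (yes isβ) = let (found , child , _) = Inv-player I isβ sd in atβ isβ found child
  byPlayer (no notβ) = subst (λ z → InvNode C′ (InvUpTo k C′) z N' M') (sym (afterNode-other {C = C} {β = β} {d} {s} {r} {k'} {lb} {kid} notβ)) (unfold notβ d refl)
                     , Measure-after I sd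

Inv-after : ∀ {C x N M β N' M'} → Inv C x N M → StepData N M β N' M' →
  Inv (AfterCoalg C β) (afterNode C β x) N' M'
Inv-after I sd k = InvUpTo-after k I sd

Inv-rootStep : ∀ {C d s r k lb kid N M} → Inv C (ncomm d s r k lb kid) N M →
  ∃[ β ] (play β ≡ playOf d s r × ∃[ S' ] Step (N , M) β S')
Inv-rootStep {d = out} I with Inv-out I
... | pc , en , _ = _ , refl , _ , stOut en zero
Inv-rootStep {d = inp} {s} {r} I with Inv-in I
... | pc , en , (h , M₀ , e₀) , toProc with toProc h
...   | j , e = _ , refl , _ , stIn en j (head⇒≈Q∷dropChannel (trans (proj₁ (~∷⇒HeadIs e₀)) (cong (_∷ labelsOn s r M₀) e)))

Inv⇒¬Deadlocked : ∀ {C x N M} → Inv C x N M → ¬ Deadlocked (N , M)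
Inv⇒¬Deadlocked {x = nend} I (_ , live) = live (proj₁ (Inv-end I) , ~[]⇒≡[] (proj₂ (Inv-end I)))
Inv⇒¬Deadlocked {x = ncomm _ _ _ _ _ _} I (stuck , _) with Inv-rootStep I
... | β , _ , S' , st = stuck β S' st

-- A maximal coherent set contains an action of the root's player, since
-- that player can move and would otherwise extend the set.
root-in-MaxCoherent : ∀ {C d s r k lb kid N M Δ} → Inv C (ncomm d s r k lb kid) N M → MaxCoherent (N , M) Δ →
  Any (λ β → play β ≡ playOf d s r) Δ
root-in-MaxCoherent {d = d} {s} {r} {N = N} {M} {Δ} I ((_ , distinctPlayers , enabled) , maximal)
  with Inv-rootStep I | any? (λ β → play β ≟ playOf d s r) Δ
... | _ | yes found = found
... | β₀ , isRoot , S' , st | no none = ⊥-elim (none (lose (maximal (β₀ ∷ Δ) extended there (here refl)) isRoot))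
  where
  extended : Coherent (N , M) (β₀ ∷ Δ)
  extended = (λ ()) , All.map (λ other same → other (trans (sym same) isRoot)) (¬Any⇒All¬ _ none) ∷ distinctPlayers
           , (S' , st) ∷ enabled

Inv-Steps : ∀ {C x N M Δ S'} → Inv C x N M → Steps (N , M) Δ S' →
  Σ Coalg λ C' → Σ (Node (State C')) λ x' → Inv C' x' (proj₁ S') (proj₂ S')
Inv-Steps I snil = _ , _ , I
Inv-Steps I (scons st rest) = Inv-Steps (Inv-after I (Step⇒StepData st)) rest

Inv-Derivative : ∀ {C x S S'} → Inv C x (proj₁ S) (proj₂ S) → Derivative S S' →
  Σ Coalg λ C' → Σ (Node (State C')) λ x' → Inv C' x' (proj₁ S') (proj₂ S')
Inv-Derivative I ε = _ , _ , I
Inv-Derivative I ((_ , _ , stps) ◅ rest) = let (_ , _ , I') = Inv-Steps I stps in Inv-Derivative I' rest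

Eventually-Steps : ∀ {C x N M Δ N' M' P B} → Inv C x N M → Steps (N , M) Δ (N' , M') → All (Avoids P) Δ →
  Eventually C P B x M → Σ Coalg λ C' → Σ (Node (State C')) λ x' → Inv C' x' N' M' × Eventually C' P B x' M'
Eventually-Steps I snil [] ev = _ , _ , I , ev
Eventually-Steps I (scons st rest) (avoid ∷ avoids) ev =
  Eventually-Steps (Inv-after I sd) rest avoids (Eventually-after avoid ev I sd)
  where sd = Step⇒StepData st

Eventually-Steps-root : ∀ {C d s r k lb kid N M Δ N' M' P B} → Inv C (ncomm d s r k lb kid) N M →
  Steps (N , M) Δ (N' , M') → All (Avoids P) Δ → Any (λ β → play β ≡ playOf d s r) Δ → ¬ P d s r →
  Eventually C P (suc B) (ncomm d s r k lb kid) M →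
  Σ Coalg λ C' → Σ (Node (State C')) λ x' → Inv C' x' N' M' × Eventually C' P B x' M'
Eventually-Steps-root I snil [] () notP ev
Eventually-Steps-root {C} {d} {s} {r} {k} {lb} {kid} {P = P} I (scons {β = β} st rest) (avoid ∷ avoids) fires notP ev
  with playOf d s r ≟ play β
... | yes isβ = Eventually-Steps (Inv-after I sd) rest avoids (Eventually-after-root I sd isβ notP ev)
  where sd = Step⇒StepData st
... | no notβ = Eventually-Steps-root (subst (λ z → Inv _ z _ _) reduct (Inv-after I sd)) rest avoids (later fires) notP
                  (subst (λ z → Eventually _ P _ z _) reduct (Eventually-after avoid ev I sd))
  where
  sd = Step⇒StepData st
  reduct = afterNode-other {C = C} {β = β} {d} {s} {r} {k} {lb} {kid} notβ
  later : ∀ {Δ} → Any (λ β' → play β' ≡ playOf d s r) (β ∷ Δ) → Any (λ β' → play β' ≡ playOf d s r) Δ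
  later (here isRoot) = ⊥-elim (notβ (sym isRoot))
  later (there found) = found

InRange : Maybe ℕ → ℕ → Set
InRange nothing k = ⊤
InRange (just m) k = k ≤ m

valid-or-ended : ∀ l k → InRange l k → ValidIx l k ⊎ l ≡ just k
valid-or-ended nothing k _ = inj₁ tt
valid-or-ended (just m) k le with m≤n⇒m<n∨m≡n le
... | inj₁ lt = inj₁ lt
... | inj₂ eq = inj₂ (cong just (sym eq))

InRange-suc : ∀ l k → ValidIx l k → InRange l (suc k)
InRange-suc nothing k _ = tt
InRange-suc (just m) k lt = lt

InRange-zero : ∀ l → InRange l 0
InRange-zero nothing = tt
InRange-zero (just m) = z≤n

acts-enabled : ∀ {S} (Cm : Computation S) k → ValidIx (len Cm) k →
  All (λ β → ∃[ S' ] Step (sess Cm k) β S') (acts Cm k)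
acts-enabled Cm k valid = proj₂ (proj₂ (proj₁ (proj₁ (steps Cm k valid))))

stuck-at-end : ∀ {S k} (Cm : Computation S) → len Cm ≡ just k → Stuck (sess Cm k)
stuck-at-end Cm eq = subst (λ l → EndsStuck l (sess Cm)) eq (final Cm)

-- Along a complete lockstep computation the measure towards P drops at
-- every step that contains no Hit action (the root of the tree always
-- fires, and it is not in P unless it is a Hit); the computation cannot
-- stop early since Inv excludes deadlock.  Hence a Hit action occurs.
module Descent {S : Session} (Cm : Computation S) (P : Dir → Participant → Participant → Set)
  (Hit : Comm → Set) (hit? : ∀ β → Dec (Hit β)) (Ok : Session → Set) (Goal : Set)
  (Ok⇒¬Terminated : ∀ {S'} → Ok S' → ¬ Terminated S')
  (hit⇒goal : ∀ {β} k → ValidIx (len Cm) k → Ok (sess Cm k) → β ∈ acts Cm k → Hit β → Goal)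
  (¬hit⇒avoids : ∀ {β} → ¬ Hit β → Avoids P β)
  (Ok-Steps : ∀ {S₁ Δ S₂} → Ok S₁ → Steps S₁ Δ S₂ → All (λ β → ¬ Hit β) Δ → Ok S₂)
  (root⇒hit : ∀ {Co d s r k lb kid N M β S'} → Inv Co (ncomm d s r k lb kid) N M → Step (N , M) β S' →
              play β ≡ playOf d s r → P d s r → Hit β)
  where

  reach : ∀ B k → InRange (len Cm) k → ∀ {Co x} → Inv Co x (proj₁ (sess Cm k)) (proj₂ (sess Cm k)) →
          Ok (sess Cm k) → Eventually Co P B x (proj₂ (sess Cm k)) → Goal
  reach zero k _ _ _ ()
  reach (suc B) k inRange {x = x} I ok ev with valid-or-ended (len Cm) k inRange
  ... | inj₂ ended = ⊥-elim (Inv⇒¬Deadlocked I (stuck-at-end Cm ended , Ok⇒¬Terminated ok))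
  ... | inj₁ valid with steps Cm k valid | any? hit? (acts Cm k)
  ...   | _ | yes someHit = let (β , mem , hit) = find someHit in hit⇒goal k valid ok mem hit
  ...   | maxCoherent , stps | no noHit = descend x I ev
    where
    descend : ∀ {Co} (x : Node (State Co)) → Inv Co x (proj₁ (sess Cm k)) (proj₂ (sess Cm k)) →
              Eventually Co P (suc B) x (proj₂ (sess Cm k)) → Goal
    descend nend I (now ())
    descend (ncomm d s r _ _ _) I ev =
      let fires = root-in-MaxCoherent I maxCoherent
          notP : ¬ P d s r
          notP p = let (β , mem , isRoot) = find fires in
                   noHit (lose mem (root⇒hit I (proj₂ (lookup (acts-enabled Cm k valid) mem)) isRoot p))
          (_ , _ , I' , ev') = Eventually-Steps-root I stps (All.map ¬hit⇒avoids (¬Any⇒All¬ _ noHit)) fires notP ev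
      in reach B (suc k) (InRange-suc (len Cm) k valid) I' (Ok-Steps ok stps (¬Any⇒All¬ _ noHit)) ev'

  descent : ∀ {Co x} → Inv Co x (proj₁ S) (proj₂ S) → Ok S → ∃[ B ] Eventually Co P B x (proj₂ S) → Goal
  descent {Co} {x} I ok (B , ev) = reach B 0 (InRange-zero (len Cm))
    (subst (λ S → Inv Co x (proj₁ S) (proj₂ S)) (sym (init Cm)) I) (subst Ok (sym (init Cm)) ok)
    (subst (λ S → Eventually Co P B x (proj₂ S)) (sym (init Cm)) ev)

step-by-input : ∀ {N M β S' p q P} {c : Choice (Fin (size P))} → Step (N , M) β S' → play β ≡ p → N p ≡ P →
  pnode P ≡ pact inp q c → ∃[ j ] (β ≡ cin q p (lab c j))
step-by-input (stOut en _) refl refl en' with trans (sym en) en'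
... | ()
step-by-input (stIn en h _) refl refl en' with trans (sym en) en'
... | refl = h , refl

Steps-other : ∀ {N M Δ N' M' p} → Steps (N , M) Δ (N' , M') → All (λ β → ¬ play β ≡ p) Δ → N' p ≡ N p
Steps-other snil [] = refl
Steps-other {p = p} (scons st rest) (notp ∷ notps) =
  trans (Steps-other rest notps) (StepData-other (Step⇒StepData st) p λ isp → notp (sym isp))

IsInputOn : Participant → Participant → Comm → Set
IsInputOn a b β = ∃[ l ] (β ≡ cin a b l)

isInputOn? : ∀ a b β → Dec (IsInputOn a b β)
isInputOn? a b (cout _ _ _) = no λ { (_ , ()) }
isInputOn? a b (cin a' b' l) with a' ≟ a | b' ≟ b
... | yes refl | yes refl = yes (l , refl)
... | no a'≢a  | _        = no λ { (_ , refl) → a'≢a refl }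
... | yes _    | no b'≢b  = no λ { (_ , refl) → b'≢b refl }

Step-keepsHead : ∀ {N M β N' M' a b l L} → StepData N M β N' M' → ¬ IsInputOn a b β → labelsOn a b M ≡ l ∷ L →
  ∃[ L' ] (labelsOn a b M' ≡ l ∷ L')
Step-keepsHead {M = M} {a = a} {b} {L = L} (sdOut {p = p} {q = q} {l = l'} _ _ _ _ _ _ eM) _ onab =
  L ++ labelsOn a b [ msg p l' q ] , trans (sym (onChannel eM a b)) (trans (labelsOn-++ a b M _) (cong (_++ labelsOn a b [ msg p l' q ]) onab))
Step-keepsHead {a = a} {b} {L = L} (sdIn {p = p} {q = q} {l = l'} _ _ _ _ _ eM _) notInput onab with sameChannel? p q a b
... | yes (refl , refl) = ⊥-elim (notInput (l' , refl))
... | no other          = L , trans (sym (proj₂ (~∷⇒HeadIs eM) a b other)) onab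

Steps-keepsHead : ∀ {N M Δ N' M' a b l} → Steps (N , M) Δ (N' , M') → All (λ β → ¬ IsInputOn a b β) Δ →
  ∃[ L ] (labelsOn a b M ≡ l ∷ L) → ∃[ L' ] (labelsOn a b M' ≡ l ∷ L')
Steps-keepsHead snil [] onab = onab
Steps-keepsHead (scons st rest) (notInput ∷ notInputs) (_ , onab) =
  Steps-keepsHead rest notInputs (Step-keepsHead (Step⇒StepData st) notInput onab)

Inv⇒InputEnabling : ∀ {Co x N M} → Inv Co x N M → InputEnabling (N , M)
Inv⇒InputEnabling {N = N} I p q c en Cm =
  Descent.descent Cm (PlayedBy p) (λ β → play β ≡ p) (λ β → play β ≟ p) (λ S' → proj₁ S' p ≡ N p)
    (∃[ j ] Occurs Cm (cin q p (lab c j)))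
    (λ same (ended , _) → inputIsLive (trans (sym (subst IsEnd same (ended p))) en))
    (λ k valid same mem isp → let (j , isInput) = step-by-input (proj₂ (lookup (acts-enabled Cm k valid) mem)) isp same en
                              in j , k , valid , subst (_∈ acts Cm k) isInput mem)
    (λ notp d s r isβ _ isp → notp (trans (sym isβ) isp))
    (λ same stps notps → trans (Steps-other stps notps) same)
    (λ _ _ isRoot isp → trans isRoot isp)
    I refl (proj₁ (Inv-measure I) p λ end → inputIsLive (trans (sym end) en))
  where
  inputIsLive : ∀ {k} {c' : Choice (Fin k)} → pend ≢ pact inp q c'
  inputIsLive ()

Inv⇒QueueConsuming : ∀ {Co x N M} → Inv Co x N M → QueueConsuming (N , M)
Inv⇒QueueConsuming {Co} {M = M} I a l b M' e Cm =
  Descent.descent Cm (InputOn a b) (IsInputOn a b) (isInputOn? a b) (λ S' → ∃[ L ] (labelsOn a b (proj₂ S') ≡ l ∷ L))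
    (Occurs Cm (cin a b l))
    (λ {S'} → queued⇒¬Terminated {proj₁ S'} {proj₂ S'})
    consumed
    avoids
    (λ onab stps notInputs → Steps-keepsHead stps notInputs onab)
    rootIsInput
    I (_ , proj₁ (~∷⇒HeadIs (≈Q⇒~ e))) (proj₂ (Inv-measure I) a l b M' (≈Q⇒~ e))
  where
  queued⇒¬Terminated : ∀ {N₁ M₁} → ∃[ L ] (labelsOn a b M₁ ≡ l ∷ L) → ¬ Terminated (N₁ , M₁)
  queued⇒¬Terminated (_ , onab) (_ , refl) with onab
  ... | ()
  consumed : ∀ {β} k → ValidIx (len Cm) k → ∃[ L ] (labelsOn a b (proj₂ (sess Cm k)) ≡ l ∷ L) →
             β ∈ acts Cm k → IsInputOn a b β → Occurs Cm (cin a b l)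
  consumed k valid (_ , onab) mem (l' , refl)
    with lookup (acts-enabled Cm k valid) mem
  ... | _ , stIn _ _ e with trans (sym onab) (trans (onChannel (≈Q⇒~ e) a b) (labelsOn-head a b l' _))
  ...   | refl = k , valid , mem
  avoids : ∀ {β} → ¬ IsInputOn a b β → Avoids (InputOn a b) β
  avoids {cout _ _ _} _ d s r _ (refl , _) ()
  avoids {cin p q l'} notInput .inp .p r isβ (refl , refl) (refl , refl) = notInput (l' , cong (λ z → cin a z l') (sym isβ))
  rootIsInput : ∀ {Co d s r k lb kid N M β S'} → Inv Co (ncomm d s r k lb kid) N M → Step (N , M) β S' →
                play β ≡ playOf d s r → InputOn a b d s r → IsInputOn a b β
  rootIsInput {d = inp} I st isRoot (refl , refl) with Inv-in I
  ... | pc , en , _ with step-by-input st isRoot refl en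
  ...   | j , refl = lab pc j , refl

Inv⇒Progress : ∀ {Co x N M} → Inv Co x N M → Progress (N , M)
Inv⇒Progress I S' derivative =
  let (_ , _ , I') = Inv-Derivative I derivative
  in Inv⇒¬Deadlocked I' , Inv⇒InputEnabling I' , Inv⇒QueueConsuming I'

nodeOf : ∀ {m} → GNode m → Node (Fin m)
nodeOf gend = nend
nodeOf (gcomm d p q ne c) = ncomm d p q (n c) (lab c) (cont c)

coalgOf : GType → Coalg
coalgOf G = record { State = Fin (gsize G) ; obs = λ s → nodeOf (ggraph G s) }

rootOf : (G : GType) → Node (State (coalgOf G))
rootOf G = nodeOf (gnode G)

at-root : ∀ {G g} (P : Node (State (coalgOf G)) → Set) → gnode G ≡ g → P (nodeOf g) → P (rootOf G)
at-root P eg = subst P (sym (cong nodeOf eg))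

~∷-branch-unique : ∀ {A Q Q₁ Q₂ p q} {c : Choice A} {h i} →
  Q ~ (msg p (lab c h) q ∷ Q₁) → Q ~ (msg p (lab c i) q ∷ Q₂) → (h ≡ i) × (Q₁ ~ Q₂)
~∷-branch-unique {c = c} e f = let (same , rest) = ~∷-unique e f in distinct c same , rest

Balanced-end : ∀ {G Q} → gnode G ≡ gend → Balanced G Q → Q ≡ []
Balanced-end eg bal with Balanced.brule bal
... | bEnd _ empty = empty
... | bOut eg' _ _ with trans (sym eg) eg'
...   | ()
Balanced-end eg bal | bIn eg' _ _ _ _ with trans (sym eg) eg'
...   | ()

Balanced-out : ∀ {G p q ne c Q} → gnode G ≡ gcomm out p q ne c → Balanced G Q →
  ∀ i → Balanced (ggoto G (cont c i)) (Q ++ [ msg p (lab c i) q ])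
Balanced-out eg bal with Balanced.brule bal
... | bEnd eg' _ with trans (sym eg) eg'
...   | ()
Balanced-out eg bal | bIn eg' _ _ _ _ with trans (sym eg) eg'
...   | ()
Balanced-out eg bal | bOut eg' _ children with trans (sym eg) eg'
...   | refl = children

Balanced-in : ∀ {G p q ne c Q} → gnode G ≡ gcomm inp p q ne c → Balanced G Q →
  ∃[ h ] ∃[ Q₁ ] (Q ≈Q (msg p (lab c h) q ∷ Q₁) × Balanced (ggoto G (cont c h)) Q₁)
Balanced-in eg bal with Balanced.brule bal
... | bEnd eg' _ with trans (sym eg) eg'
...   | ()
Balanced-in eg bal | bOut eg' _ _ with trans (sym eg) eg'
...   | ()
Balanced-in eg bal | bIn eg' h eQ _ child with trans (sym eg) eg'
...   | refl = h , _ , eQ , child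

Balanced-read : ∀ {G Q} → Balanced G Q → Read G Q
Balanced-read bal with Balanced.brule bal
... | bEnd _ refl = rEmpty
... | bOut _ rd _ = rd
... | bIn _ _ _ rd _ = rd

-- Balancing lets exactly one branch of an input through, so a bound for
-- that branch bounds the node.
eventually-balancedIn : ∀ {G p q ne c Q h Q₁ P} → gnode G ≡ gcomm inp p q ne c → Q ≈Q (msg p (lab c h) q ∷ Q₁) →
  ∃[ B ] Eventually (coalgOf G) P B (nodeOf (ggraph G (cont c h))) Q₁ → ∃[ B ] Eventually (coalgOf G) P B (rootOf G) Q
eventually-balancedIn {G} {p} {q} {c = c} {Q} {h} {P = P} eg eQ (B , ev) =
  at-root {G} (λ x → ∃[ B ] Eventually (coalgOf G) P B x Q) eg
    (eventually-in {C = coalgOf G} {lb = lab c} (h , _ , ≈Q⇒~ eQ) λ i Q₂ e₂ → branch i Q₂ (~∷-branch-unique {c = c} (≈Q⇒~ eQ) e₂))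
  where
  branch : ∀ i Q₂ → (h ≡ i) × (_ ~ Q₂) → ∃[ B ] Eventually (coalgOf G) P B (nodeOf (ggraph G (cont c i))) Q₂
  branch i Q₂ (refl , rest) = B , Eventually-~ ev rest

Within⇒Eventually : ∀ {B G z Q} → Within B G z → Balanced G Q → ∃[ B' ] Eventually (coalgOf G) (PlayedBy z) B' (rootOf G) Q
Within⇒Eventually {suc B} {G} {Q = Q} (wHere {d = d} {p} {q} eg) bal =
  suc B , at-root {G} (λ x → Eventually (coalgOf G) (PlayedBy (playOf d p q)) (suc B) x Q) eg (now refl)
Within⇒Eventually {G = G} {z} {Q} (wthere {d = out} {c = c} eg within) bal =
  at-root {G} (λ x → ∃[ B ] Eventually (coalgOf G) (PlayedBy z) B x Q) eg
    (eventually-out {C = coalgOf G} {lb = lab c} λ i → Within⇒Eventually (within i) (Balanced-out {G} eg bal i))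
Within⇒Eventually {G = G} (wthere {d = inp} eg within) bal =
  let (h , _ , eQ , child) = Balanced-in {G} eg bal in eventually-balancedIn {G} eg eQ (Within⇒Eventually (within h) child)

Read-miss⇒empty : ∀ {R Q Q₁ Y p l q} → (∀ M' → ¬ (R ≈Q (msg p l q ∷ M'))) → Q ~ (R ++ Y) → Q ~ (msg p l q ∷ Q₁) →
  labelsOn p q R ≡ []
Read-miss⇒empty {R} {Q} {Y = Y} {p} {l} {q} miss e e₁ = empty (labelsOn p q R) refl
  where
  onQ : labelsOn p q Q ≡ labelsOn p q R ++ labelsOn p q Y
  onQ = trans (onChannel e p q) (labelsOn-++ p q R Y)
  empty : ∀ L → labelsOn p q R ≡ L → labelsOn p q R ≡ []
  empty [] onR = onR
  empty (l' ∷ _) onR with ∷-injective (trans (sym (proj₁ (~∷⇒HeadIs e₁))) (trans onQ (cong (_++ labelsOn p q Y) onR)))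
  ... | refl , _ = ⊥-elim (miss _ (head⇒≈Q∷dropChannel onR))

~-++-past : ∀ {R Y Y₁ p l q} → labelsOn p q R ≡ [] → Y ~ (msg p l q ∷ Y₁) → (R ++ Y) ~ (msg p l q ∷ (R ++ Y₁))
~-++-past {R} {Y} {Y₁} {p} {l} {q} empty e = HeadIs⇒~∷ (onpq , onOther)
  where
  onpq : labelsOn p q (R ++ Y) ≡ l ∷ labelsOn p q (R ++ Y₁)
  onpq = begin
    labelsOn p q (R ++ Y)                    ≡⟨ labelsOn-++ p q R Y ⟩
    labelsOn p q R ++ labelsOn p q Y         ≡⟨ cong (_++ labelsOn p q Y) empty ⟩
    labelsOn p q Y                           ≡⟨ proj₁ (~∷⇒HeadIs e) ⟩
    l ∷ labelsOn p q Y₁                      ≡⟨ cong (λ L → l ∷ L ++ labelsOn p q Y₁) empty ⟨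
    l ∷ labelsOn p q R ++ labelsOn p q Y₁    ≡⟨ cong (l ∷_) (labelsOn-++ p q R Y₁) ⟨
    l ∷ labelsOn p q (R ++ Y₁)               ∎
  onOther : ∀ s r → ¬ SameChannel p q s r → labelsOn s r (R ++ Y) ≡ labelsOn s r (R ++ Y₁)
  onOther s r other = trans (labelsOn-++ s r R Y)
    (trans (cong (labelsOn s r R ++_) (proj₂ (~∷⇒HeadIs e) s r other)) (sym (labelsOn-++ s r R Y₁)))

-- R is a prefix of Q that G can read, so every message of R is read
-- within the finite depth of the readability derivation.
Read⇒Eventually : ∀ {G R Q Y a l b L} → Read G R → Balanced G Q → Q ~ (R ++ Y) → labelsOn a b R ≡ l ∷ L →
  ∃[ B ] Eventually (coalgOf G) (InputOn a b) B (rootOf G) Q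
Read⇒Eventually rEmpty bal e ()
Read⇒Eventually {G} {R} {Q} {Y} {a} {b = b} (rOut {p} {q} {c = c} eg reads) bal e onab =
  at-root {G} (λ x → ∃[ B ] Eventually (coalgOf G) (InputOn a b) B x Q) eg
    (eventually-out {C = coalgOf G} {lb = lab c} λ i → Read⇒Eventually (reads i) (Balanced-out {G} eg bal i)
      (~-trans (~-++ [ msg p (lab c i) q ] e) (≡⇒~ (++-assoc R Y [ msg p (lab c i) q ]))) onab)
Read⇒Eventually {G} {R} {Q} {Y} {a} {b = b} (rInHit {p} {q} eg h eR reads) bal e onab with sameChannel? p q a b
... | yes (refl , refl) = 1 , at-root {G} (λ x → Eventually (coalgOf G) (InputOn a b) 1 x Q) eg (now (refl , refl))
... | no other = let (h' , _ , eQ , child) = Balanced-in {G} eg bal in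
      eventually-balancedIn {G} eg eQ (Read⇒Eventually (reads h') child
        (proj₂ (~∷-unique (≈Q⇒~ eQ) (~-trans e (~-++ Y (≈Q⇒~ eR))))) (trans (sym (proj₂ (~∷⇒HeadIs (≈Q⇒~ eR)) a b other)) onab))
Read⇒Eventually {G} {R} {Q} {Y} {a} {b = b} (rInMiss {p} {q} eg miss reads) bal e onab with sameChannel? p q a b
... | yes (refl , refl) = 1 , at-root {G} (λ x → Eventually (coalgOf G) (InputOn a b) 1 x Q) eg (now (refl , refl))
... | no other = let (h' , _ , eQ , child) = Balanced-in {G} eg bal
                     empty = Read-miss⇒empty {R} (miss h') e (≈Q⇒~ eQ)
                     fromY = head⇒~∷dropChannel (trans (sym (cong (_++ labelsOn p q Y) empty))
                               (trans (sym (trans (onChannel e p q) (labelsOn-++ p q R Y))) (proj₁ (~∷⇒HeadIs (≈Q⇒~ eQ)))))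
      in eventually-balancedIn {G} eg eQ (Read⇒Eventually (reads h') child
           (proj₂ (~∷-unique (≈Q⇒~ eQ) (~-trans e (~-++-past {R} empty fromY)))) onab)

Typed-plays : ∀ {G N z} → Typed G N → InPlaysN N z → Plays G z
Typed-plays {z = z} ty active with Typed.rule ty
... | tEnd _ allEnd = ⊥-elim (active (allEnd z))
... | tOut {p = p} eg _ _ toGlobal children with z ≟ p
...   | yes refl = phere eg
...   | no z≢p = let (i , e) = toGlobal zero in pthere eg i (proj₂ (proj₂ (children i zero e) z z≢p) active)
Typed-plays {z = z} ty active | tIn {p = p} eg _ toProc children with z ≟ p
...   | yes refl = phere eg
...   | no z≢p = let (j , e) = toProc zero in pthere eg zero (proj₂ (proj₂ (children zero j (sym e)) z z≢p) active)

Bounded-child : ∀ {G d p q ne c} → Bounded G → gnode G ≡ gcomm d p q ne c → ∀ i → Bounded (ggoto G (cont c i))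
Bounded-child bounded eg i G' occurs r plays = bounded G' (ochild eg i occurs) r plays

Typed⇒Measure : ∀ {G N Q} → Typed G N → Balanced G Q → Bounded G → Measure (coalgOf G) (rootOf G) N Q
Typed⇒Measure {G} ty bal bounded =
  (λ z active → let (B , within) = bounded G oself z (Typed-plays ty active) in Within⇒Eventually within bal) ,
  (λ a l b M' e → Read⇒Eventually (Balanced-read bal) bal (≡⇒~ (sym (++-identityʳ _))) (proj₁ (~∷⇒HeadIs e)))

Typed⇒InvUpTo : ∀ k {G N Q} → Typed G N → Balanced G Q → Bounded G → InvUpTo k (coalgOf G) (rootOf G) N Q
Typed⇒InvUpTo zero ty bal bounded = tt
Typed⇒InvUpTo (suc k) {G} {N} {Q} ty bal bounded = unfold (Typed.rule ty) , Typed⇒Measure ty bal bounded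
  where
  Unfolded = InvNode (coalgOf G) (InvUpTo k (coalgOf G))
  unfold : TyRule G N → Unfolded (rootOf G) N Q
  unfold (tEnd eg allEnd) = at-root {G} (λ x → Unfolded x N Q) eg (iEnd allEnd (≡⇒~ (Balanced-end {G} eg bal)))
  unfold (tOut {pc = pc} eg en toProc toGlobal children) = at-root {G} (λ x → Unfolded x N Q) eg
    (iOut pc refl en toGlobal (λ i → let (j , e) = toProc i in j , sym e)
      λ i j e → Typed⇒InvUpTo k (proj₁ (children i j e)) (Balanced-out {G} eg bal i) (Bounded-child {G} bounded eg i))
  unfold (tIn {p} {q} {c = c} {pc} eg en toProc children) with Balanced-in {G} eg bal
  ... | h , Q₁ , eQ , child = at-root {G} (λ x → Unfolded x N Q) eg
    (iIn pc refl en (h , Q₁ , ≈Q⇒~ eQ) (λ i → let (j , e) = toProc i in j , sym e)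
      λ i j M' e e' → branch i j M' e (~∷-branch-unique {c = c} (≈Q⇒~ eQ) e'))
    where
    branch : ∀ i j M' → lab c i ≡ lab pc j → (h ≡ i) × (Q₁ ~ M') →
             InvUpTo k (coalgOf G) (nodeOf (ggraph G (cont c i))) (update N p (goto (N p) (cont pc j))) M'
    branch i j M' e (refl , rest) =
      InvUpTo-resp k (Typed⇒InvUpTo k (proj₁ (children h j e)) child (Bounded-child {G} bounded eg h)) (λ _ → refl) rest

theorem4p20 : (G : GType) (N : Network) (M : Queue) → IsNetwork N →
    Typed G N → Bounded G → Balanced G M → Progress (N , M)
theorem4p20 G N M _ typed bounded balanced = Inv⇒Progress (λ k → Typed⇒InvUpTo k typed balanced bounded)
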